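{- For every integer $n\ge 2$, $$\mathrm{SgnBAltrun}_{n,-,a}(p,q)=(1-pq)\,\mathrm{SgnBAltrun}_{n-2,-,a}(p,q),\qquad \mathrm{SgnBAltrun}_{n,-,d}(p,q)=(1-pq)\,\mathrm{SgnBAltrun}_{n-2,-,d}(p,q),$$ and consequently $$\mathrm{SgnBAltrun}_{n,-,a}(p,q)=\begin{cases}(1-q)(1-pq)^{k-1}& n=2k,\\ (1-pq)^k & n=2k+1,\end{cases}\qquad \mathrm{SgnBAltrun}_{n,-,d}(p,q)=\begin{cases}(1-p)(1-pq)^{k-1}& n=2k,\\ -(1-pq)^k & n=2k+1,\end{cases}$$ $$\mathrm{SgnBAltrun}_{n}(p,q)=\begin{cases}(2-p-q)(1-pq)^{k-1}& n=2k,\\ 0 & n \text{ odd}.\end{cases}$$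
   Context: $\mathfrak{B}_n$ is the group of signed permutations, written in window notation $\pi=\pi_1\cdots\pi_n$ with $\pi_i\in\{\pm1,\dots,\pm n\}$ and $\{|\pi_1|,\dots,|\pi_n|\}=[n]$. Its length is $\mathrm{inv}_B(\pi)=|\{1\le i<j\le n:\pi_i>\pi_j\}|+|\{1\le i<j\le n:-\pi_i>\pi_j\}|+|\{i:\pi_i<0\}|$ (comparisons in the usual order on $\mathbb{Z}$). Set $\pi_0=0$. Let $\mathrm{pk}_B(\pi)$ be the number of $i\in\{1,\dots,n-1\}$ with $\pi_{i-1}<\pi_i>\pi_{i+1}$, and $\mathrm{val}_B(\pi)$ the number of $i\in\{1,\dots,n-1\}$ with $\pi_{i-1}>\pi_i<\pi_{i+1}$. Let $\mathfrak{B}_{n,-,a}=\{\pi\in\mathfrak{B}_n:\pi_{n-1}<\pi_n\}$ and $\mathfrak{B}_{n,-,d}=\{\pi\in\mathfrak{B}_n:\pi_{n-1}>\pi_n\}$. Define $\mathrm{SgnBAltrun}_{n,-,a}(p,q)=\sum_{\pi\in\mathfrak{B}_{n,-,a}}(-1)^{\mathrm{inv}_B(\pi)}p^{\mathrm{pk}_B(\pi)}q^{\mathrm{val}_B(\pi)}$, similarly $\mathrm{SgnBAltrun}_{n,-,d}$ over $\mathfrak{B}_{n,-,d}$, and $\mathrm{SgnBAltrun}_{n}$ over all of $\mathfrak{B}_n$. -}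

module Defs where

open import Data.Bool using (Bool; true; false; not; if_then_else_; _∧_)
open import Data.Nat as ℕ using (ℕ; zero; suc)
open import Data.Integer as ℤ using (ℤ; +_; -_; ∣_∣; _≤ᵇ_)
open import Data.List using (List; []; _∷_; map; concatMap; filterᵇ; upTo; length)
open import Data.Bool.ListAction using (all; any)

infix 4 _<ᶻ_
_<ᶻ_ : ℤ → ℤ → Bool
x <ᶻ y = not (y ≤ᵇ x)

letters : ℕ → List ℤ
letters n = concatMap (λ j → + suc j ∷ - (+ suc j) ∷ []) (upTo n)

words : ℕ → ℕ → List (List ℤ)
words n zero    = [] ∷ []
words n (suc m) = concatMap (λ w → map (_∷ w) (letters n)) (words n m)

-- a word of length n over {±1,…,±n} is a signed permutation (window notation)
-- iff every j ∈ [n] occurs as some |π_i|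
isSignedPerm : ℕ → List ℤ → Bool
isSignedPerm n w = all (λ j → any (λ x → ∣ x ∣ ℕ.≡ᵇ suc j) w) (upTo n)

signedPerms : ℕ → List (List ℤ)
signedPerms n = filterᵇ (isSignedPerm n) (words n n)

countᵇ : {A : Set} → (A → Bool) → List A → ℕ
countᵇ p []       = zero
countᵇ p (x ∷ xs) = if p x then suc (countᵇ p xs) else countᵇ p xs

-- inv_B(π) = #{i<j : π_i > π_j} + #{i<j : -π_i > π_j} + #{i : π_i < 0}
invB : List ℤ → ℕ
invB []       = zero
invB (x ∷ xs) =
  countᵇ (λ y → y <ᶻ x) xs ℕ.+ countᵇ (λ y → y <ᶻ (- x)) xs
  ℕ.+ (if x <ᶻ + 0 then 1 else 0) ℕ.+ invB xs

countTriples : (ℤ → ℤ → ℤ → Bool) → List ℤ → ℕ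
countTriples r (a ∷ b ∷ c ∷ xs) =
  (if r a b c then 1 else 0) ℕ.+ countTriples r (b ∷ c ∷ xs)
countTriples r _ = zero

-- with π_0 = 0, the triples of 0 π_1 ⋯ π_n are (π_{i-1},π_i,π_{i+1}), i = 1..n-1
pkB : List ℤ → ℕ
pkB w = countTriples (λ a b c → (a <ᶻ b) ∧ (c <ᶻ b)) (+ 0 ∷ w)

valB : List ℤ → ℕ
valB w = countTriples (λ a b c → (b <ᶻ a) ∧ (b <ᶻ c)) (+ 0 ∷ w)

lastTwo : (ℤ → ℤ → Bool) → List ℤ → Bool
lastTwo r (a ∷ b ∷ []) = r a b
lastTwo r (a ∷ b ∷ c ∷ xs) = lastTwo r (b ∷ c ∷ xs)
lastTwo r _ = false

-- π ∈ 𝔅_{n,-,a} : π_{n-1} < π_n   (with π_0 = 0)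
endAsc : List ℤ → Bool
endAsc w = lastTwo (λ a b → a <ᶻ b) (+ 0 ∷ w)

endDesc : List ℤ → Bool
endDesc w = lastTwo (λ a b → b <ᶻ a) (+ 0 ∷ w)

weight : ℤ → ℤ → List ℤ → ℤ
weight p q w = ((- + 1) ℤ.^ invB w) ℤ.* (p ℤ.^ pkB w) ℤ.* (q ℤ.^ valB w)

sumℤ : List ℤ → ℤ
sumℤ []       = + 0
sumℤ (x ∷ xs) = x ℤ.+ sumℤ xs

-- the polynomials, evaluated at integers p, q
SgnBAltrun : ℕ → ℤ → ℤ → ℤ
SgnBAltrun n p q = sumℤ (map (weight p q) (signedPerms n))

SgnBAltrunA : ℕ → ℤ → ℤ → ℤ
SgnBAltrunA n p q = sumℤ (map (weight p q) (filterᵇ endAsc (signedPerms n)))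

SgnBAltrunD : ℕ → ℤ → ℤ → ℤ
SgnBAltrunD n p q = sumℤ (map (weight p q) (filterᵇ endDesc (signedPerms n)))

-- Every signed permutation of [n + 1] arises exactly once by inserting n + 1 or -(n + 1) into a
-- signed permutation of [n].  Refine the weight (-1)^inv_B p^pk_B q^val_B of a word by a boundary
-- function g : Bool → Bool → ℤ of the directions of its first step (from π₀ = 0) and its last
-- step.  The signed weights of the 2(n + 1) insertions into a fixed word add up to the weight of
-- that word refined by a new boundary function, obtained from g by a linear map that depends only
-- on the parity of the length; this is proved by induction along the word, absorbing the peak or
-- valley factor of its first letter into g.  Solving the resulting recursion for the refined sums
-- over all signed permutations, two consecutive insertion steps multiply them by 1 - pq.  The
-- three sums of the theorem are the refined sums for the boundary functions [last step up],
-- [last step down] and 1.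

module Submission where

open import Defs
open import Data.Nat using (ℕ; suc; _+_; _*_)
open import Data.Integer using (ℤ; +_; -_; _-_) renaming (_*_ to _*ℤ_; _^_ to _^ℤ_)
open import Data.Product using (_×_)
open import Relation.Binary.PropositionalEquality using (_≡_)

open import Data.Bool using (Bool; true; false; not; _∧_; if_then_else_; T; T?)
open import Data.Empty using (⊥; ⊥-elim)
open import Data.Integer using (-[1+_]; 0ℤ; 1ℤ; -1ℤ) renaming (_+_ to _+ℤ_)
import Data.Integer as ℤ
import Data.Integer.Properties as ℤₚ
open import Data.Integer.Tactic.RingSolver using (solve-∀)
open import Algebra.Properties.CommutativeSemigroup ℤₚ.+-commutativeSemigroup using (x∙yz≈y∙xz)
open import Data.List using (List; []; _∷_; map; concatMap; filter; filterᵇ; _++_; length; upTo)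
import Data.List.Properties as Listₚ
open import Data.List.Membership.Propositional using (_∈_; find; lose)
open import Data.List.Membership.Propositional.Properties
  using (∈-map⁺; ∈-map⁻; ∈-++⁻; ∈-++⁺ˡ; ∈-++⁺ʳ; ∈-concatMap⁺; ∈-concatMap⁻; ∈-filter⁺; ∈-filter⁻;
         ∈-upTo⁺; ∈-upTo⁻; ∈-∃++)
open import Data.List.Membership.Propositional.Properties.WithK using (unique∧set⇒bag)
open import Data.List.Relation.Binary.BagAndSetEquality using (∼bag⇒↭)
open import Data.List.Relation.Binary.Permutation.Propositional as ↭ using (_↭_)
open import Data.List.Relation.Unary.All as All using (All; []; _∷_)
import Data.List.Relation.Unary.All.Properties as Allₚ
open import Data.List.Relation.Unary.AllPairs using ([]; _∷_)
open import Data.List.Relation.Unary.Any as Any using (Any; here; there)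
import Data.List.Relation.Unary.Any.Properties as Anyₚ
open import Data.List.Relation.Unary.Linked using (Linked; []; [-]; _∷_)
open import Data.List.Relation.Unary.Unique.Propositional using (Unique)
import Data.List.Relation.Unary.Unique.Propositional.Properties as Uniqueₚ
open import Data.Nat using (zero)
import Data.Nat as ℕ
import Data.Nat.Properties as ℕₚ
import Data.Nat.Tactic.RingSolver as ℕ-Solver
open import Data.Product using (∃; ∃₂; _,_; proj₁; proj₂)
open import Data.Sum using (_⊎_; inj₁; inj₂)
open import Data.Unit using (tt)
open import Function using (_∘_)
open import Function.Bundles using (mk⇔)
open import Relation.Binary.Definitions using (tri<; tri≈; tri>)
open import Relation.Binary.PropositionalEquality
  using (_≢_; ≢-sym; refl; sym; trans; cong; cong₂; subst; module ≡-Reasoning)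
open import Relation.Nullary using (¬_; ¬?)

private
  variable
    A B : Set

sumℤ-map-++ : ∀ (f : A → ℤ) xs ys →
              sumℤ (map f (xs ++ ys)) ≡ sumℤ (map f xs) +ℤ sumℤ (map f ys)
sumℤ-map-++ f []       ys = sym (ℤₚ.+-identityˡ _)
sumℤ-map-++ f (x ∷ xs) ys =
  trans (cong (f x +ℤ_) (sumℤ-map-++ f xs ys)) (sym (ℤₚ.+-assoc (f x) _ _))

sumℤ-map-cong : ∀ {f g : A → ℤ} xs → (∀ {x} → x ∈ xs → f x ≡ g x) →
                sumℤ (map f xs) ≡ sumℤ (map g xs)
sumℤ-map-cong []       f≗g = refl
sumℤ-map-cong (x ∷ xs) f≗g = cong₂ _+ℤ_ (f≗g (here refl)) (sumℤ-map-cong xs (f≗g ∘ there))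

sumℤ-map-*ˡ : ∀ c (f : A → ℤ) xs → sumℤ (map (λ x → c *ℤ f x) xs) ≡ c *ℤ sumℤ (map f xs)
sumℤ-map-*ˡ c f []       = sym (ℤₚ.*-zeroʳ c)
sumℤ-map-*ˡ c f (x ∷ xs) =
  trans (cong (c *ℤ f x +ℤ_) (sumℤ-map-*ˡ c f xs)) (sym (ℤₚ.*-distribˡ-+ c (f x) _))

sumℤ-map-concatMap : ∀ (f : B → ℤ) (g : A → List B) xs →
  sumℤ (map f (concatMap g xs)) ≡ sumℤ (map (λ x → sumℤ (map f (g x))) xs)
sumℤ-map-concatMap f g []       = refl
sumℤ-map-concatMap f g (x ∷ xs) =
  trans (sumℤ-map-++ f (g x) (concatMap g xs)) (cong (sumℤ (map f (g x)) +ℤ_) (sumℤ-map-concatMap f g xs))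

sumℤ-map-filterᵇ : ∀ (P : A → Bool) (f : A → ℤ) xs →
  sumℤ (map f (filterᵇ P xs)) ≡ sumℤ (map (λ x → if P x then f x else 0ℤ) xs)
sumℤ-map-filterᵇ P f []       = refl
sumℤ-map-filterᵇ P f (x ∷ xs) with P x
... | true  = cong (f x +ℤ_) (sumℤ-map-filterᵇ P f xs)
... | false = trans (sumℤ-map-filterᵇ P f xs) (sym (ℤₚ.+-identityˡ _))

sumℤ-map-↭ : ∀ (f : A → ℤ) {xs ys} → xs ↭ ys → sumℤ (map f xs) ≡ sumℤ (map f ys)
sumℤ-map-↭ f ↭.refl          = refl
sumℤ-map-↭ f (↭.prep x p)    = cong (f x +ℤ_) (sumℤ-map-↭ f p)
sumℤ-map-↭ f (↭.swap x y p)  =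
  trans (x∙yz≈y∙xz (f x) (f y) _) (cong (λ s → f y +ℤ (f x +ℤ s)) (sumℤ-map-↭ f p))
sumℤ-map-↭ f (↭.trans p₁ p₂) = trans (sumℤ-map-↭ f p₁) (sumℤ-map-↭ f p₂)

sgn : ℕ → ℤ
sgn k = (- + 1) ^ℤ k

sgn-+ : ∀ m n → sgn (m + n) ≡ sgn m *ℤ sgn n
sgn-+ = ℤₚ.^-distribˡ-+-* (- + 1)

sgn-+2 : ∀ n → sgn (suc (suc n)) ≡ sgn n
sgn-+2 n = trans (sgn-+ 2 n) (ℤₚ.*-identityˡ (sgn n))

sgn-double : ∀ m n → sgn (m + m + n) ≡ sgn n
sgn-double zero    n = refl
sgn-double (suc m) n =
  trans (cong (λ k → sgn (suc k + n)) (ℕₚ.+-suc m m)) (trans (sgn-+2 (m + m + n)) (sgn-double m n))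

indicator : Bool → ℕ
indicator b = if b then 1 else 0

countᵇ-all : ∀ (P : A → Bool) {w} → All (λ y → P y ≡ true) w → countᵇ P w ≡ length w
countᵇ-all P []            = refl
countᵇ-all P (Py ∷ Pw) rewrite Py = cong suc (countᵇ-all P Pw)

countᵇ-none : ∀ (P : A → Bool) {w} → All (λ y → P y ≡ false) w → countᵇ P w ≡ 0
countᵇ-none P []            = refl
countᵇ-none P (¬Py ∷ ¬Pw) rewrite ¬Py = countᵇ-none P ¬Pw

countᵇ-insert : ∀ (P : A → Bool) as z bs →
                countᵇ P (as ++ z ∷ bs) ≡ indicator (P z) + countᵇ P (as ++ bs)
countᵇ-insert P []       z bs with P z
... | true  = refl
... | false = refl
countᵇ-insert P (a ∷ as) z bs with P a
... | true  = trans (cong suc (countᵇ-insert P as z bs)) (sym (ℕₚ.+-suc _ _))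
... | false = countᵇ-insert P as z bs

<ᶻ-true : ∀ {x y} → x ℤ.< y → (x <ᶻ y) ≡ true
<ᶻ-true {x} {y} x<y with y ℤ.≤ᵇ x in eq
... | true  = ⊥-elim (ℤₚ.<⇒≱ x<y (ℤₚ.≤ᵇ⇒≤ (subst T (sym eq) tt)))
... | false = refl

<ᶻ-false : ∀ {x y} → y ℤ.≤ x → (x <ᶻ y) ≡ false
<ᶻ-false {x} {y} y≤x with y ℤ.≤ᵇ x in eq
... | true  = refl
... | false = ⊥-elim (subst T eq (ℤₚ.≤⇒≤ᵇ y≤x))

<ᶻ-flip : ∀ {x y} → x ≢ y → (y <ᶻ x) ≡ not (x <ᶻ y)
<ᶻ-flip {x} {y} x≢y with ℤₚ.<-cmp x y
... | tri< x<y _ _ = trans (<ᶻ-false (ℤₚ.<⇒≤ x<y)) (cong not (sym (<ᶻ-true x<y)))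
... | tri≈ _ x≡y _ = ⊥-elim (x≢y x≡y)
... | tri> _ _ y<x = trans (<ᶻ-true y<x) (cong not (sym (<ᶻ-false (ℤₚ.<⇒≤ y<x))))

InRange : ℕ → ℤ → Set
InRange N y = - + N ℤ.< y × y ℤ.< + N

InRange-suc : ∀ {N y} → InRange N y → InRange (suc N) y
InRange-suc {N} (-N<y , y<N) =
  ℤₚ.<-trans (ℤₚ.neg-mono-< (ℤ.+<+ (ℕₚ.n<1+n N))) -N<y , ℤₚ.<-trans y<N (ℤ.+<+ (ℕₚ.n<1+n N))

0-InRange : ∀ {N} → InRange (suc N) (+ 0)
0-InRange = ℤ.-<+ , ℤ.+<+ (ℕ.s≤s ℕ.z≤n)

module InRange {n : ℕ} {y : ℤ} (y∈ : InRange (suc n) y) where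

  <top : (y <ᶻ + suc n) ≡ true
  <top = <ᶻ-true (proj₂ y∈)

  top≮ : (+ suc n <ᶻ y) ≡ false
  top≮ = <ᶻ-false (ℤₚ.<⇒≤ (proj₂ y∈))

  bottom< : (- + suc n <ᶻ y) ≡ true
  bottom< = <ᶻ-true (proj₁ y∈)

  ≮bottom : (y <ᶻ - + suc n) ≡ false
  ≮bottom = <ᶻ-false (ℤₚ.<⇒≤ (proj₁ y∈))

  top≮- : (+ suc n <ᶻ - y) ≡ false
  top≮- = <ᶻ-false (ℤₚ.<⇒≤ (ℤₚ.neg-mono-< (proj₁ y∈)))

  bottom<- : (- + suc n <ᶻ - y) ≡ true
  bottom<- = <ᶻ-true (ℤₚ.neg-mono-< (proj₂ y∈))

  ≢top : y ≢ + suc n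
  ≢top refl = ℤₚ.<-irrefl refl (proj₂ y∈)

  ≢bottom : y ≢ - + suc n
  ≢bottom refl = ℤₚ.<-irrefl refl (proj₁ y∈)

all-insert : ∀ {P : A → Set} as {x bs} → All P (as ++ bs) → P x → All P (as ++ x ∷ bs)
all-insert as Pρ Px = Allₚ.++⁺ (Allₚ.++⁻ˡ as Pρ) (Px ∷ Allₚ.++⁻ʳ as Pρ)

all-remove : ∀ {P : A → Set} as {x bs} → All P (as ++ x ∷ bs) → All P (as ++ bs)
all-remove as Pτ = Allₚ.++⁺ (Allₚ.++⁻ˡ as Pτ) (All.tail (Allₚ.++⁻ʳ as Pτ))

any-insert : ∀ {P : A → Set} as {x bs} → Any P (as ++ bs) → Any P (as ++ x ∷ bs)
any-insert as Pρ with Anyₚ.++⁻ as Pρ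
... | inj₁ Pas = Anyₚ.++⁺ˡ Pas
... | inj₂ Pbs = Anyₚ.++⁺ʳ as (there Pbs)

any-remove : ∀ {P : A → Set} as {x bs} → Any P (as ++ x ∷ bs) → ¬ P x → Any P (as ++ bs)
any-remove as Pτ ¬Px with Anyₚ.++⁻ as Pτ
... | inj₁ Pas         = Anyₚ.++⁺ˡ Pas
... | inj₂ (here Px)   = ⊥-elim (¬Px Px)
... | inj₂ (there Pbs) = Anyₚ.++⁺ʳ as Pbs

Unique-concatMap⁺ : ∀ (f : A → List B) {xs} → Unique xs → (∀ {x} → x ∈ xs → Unique (f x)) →
                    (∀ {x x′ y} → x ∈ xs → x′ ∈ xs → y ∈ f x → y ∈ f x′ → x ≡ x′) →
                    Unique (concatMap f xs)
Unique-concatMap⁺ f {[]}     _            _       _    = []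
Unique-concatMap⁺ f {x ∷ xs} (x∉xs ∷ !xs) !blocks same =
  Uniqueₚ.++⁺ (!blocks (here refl))
              (Unique-concatMap⁺ f !xs (!blocks ∘ there) (λ x∈ x′∈ → same (there x∈) (there x′∈)))
              separate
  where
  separate : ∀ {y} → y ∈ f x × y ∈ concatMap f xs → ⊥
  separate (y∈fx , y∈rest) with find (∈-concatMap⁻ f {xs = xs} y∈rest)
  ... | x′ , x′∈xs , y∈fx′ = All.lookup x∉xs x′∈xs (same (here refl) (there x′∈xs) y∈fx y∈fx′)

insertions : ℤ → List ℤ → List (List ℤ)
insertions z []       = (z ∷ []) ∷ []
insertions z (y ∷ ys) = (z ∷ y ∷ ys) ∷ map (y ∷_) (insertions z ys)

insertions± : ℕ → List ℤ → List (List ℤ)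
insertions± N σ = insertions (+ N) σ ++ insertions (- + N) σ

±-abs : ∀ {n z} → z ≡ + suc n ⊎ z ≡ - + suc n → ℤ.∣ z ∣ ≡ suc n
±-abs (inj₁ refl) = refl
±-abs (inj₂ refl) = refl

abs-± : ∀ {n} z → ℤ.∣ z ∣ ≡ suc n → z ≡ + suc n ⊎ z ≡ - + suc n
abs-± (+ _)      refl = inj₁ refl
abs-± -[1+ _ ] refl = inj₂ refl

∈-insertions⁻ : ∀ {z} ρ {τ} → τ ∈ insertions z ρ →
                ∃₂ λ as bs → ρ ≡ as ++ bs × τ ≡ as ++ z ∷ bs
∈-insertions⁻ []       (here refl) = [] , [] , refl , refl
∈-insertions⁻ (y ∷ ys) (here refl) = [] , y ∷ ys , refl , refl
∈-insertions⁻ (y ∷ ys) (there τ∈) with ∈-map⁻ (y ∷_) τ∈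
... | τ₀ , τ₀∈ , refl with ∈-insertions⁻ ys τ₀∈
... | as , bs , refl , refl = y ∷ as , bs , refl , refl

∈-insertions⁺ : ∀ as z bs → as ++ z ∷ bs ∈ insertions z (as ++ bs)
∈-insertions⁺ []       z []       = here refl
∈-insertions⁺ []       z (b ∷ bs) = here refl
∈-insertions⁺ (a ∷ as) z bs       = there (∈-map⁺ (a ∷_) (∈-insertions⁺ as z bs))

[]∉insertions : ∀ {z} ρ → [] ∈ insertions z ρ → ⊥
[]∉insertions ρ []∈ with ∈-insertions⁻ ρ []∈
... | [] , _ , _ , ()
... | _ ∷ _ , _ , _ , ()

linked-insertions : ∀ {x z ρ τ} → All (z ≢_) (x ∷ ρ) → Linked _≢_ (x ∷ ρ) →
                    τ ∈ insertions z ρ → Linked _≢_ (x ∷ τ)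
linked-insertions {ρ = []}     (z≢x ∷ []) [-] (here refl) = ≢-sym z≢x ∷ [-]
linked-insertions {ρ = y ∷ ys} (z≢x ∷ z≢y ∷ _) (x≢y ∷ l) (here refl) = ≢-sym z≢x ∷ z≢y ∷ l
linked-insertions {ρ = y ∷ ys} (_ ∷ z∉y∷ys) (x≢y ∷ l) (there τ∈) with ∈-map⁻ (y ∷_) τ∈
... | τ₀ , τ₀∈ , refl = x≢y ∷ linked-insertions z∉y∷ys l τ₀∈

all-insertions : ∀ {P : ℤ → Set} {z ρ τ} → P z → All P ρ → τ ∈ insertions z ρ → All P τ
all-insertions {ρ = ρ} Pz Pρ τ∈ with ∈-insertions⁻ ρ τ∈
... | as , bs , refl , refl = all-insert as Pρ Pz

inserted∈insertions : ∀ {z} ρ {τ} → τ ∈ insertions z ρ → z ∈ τ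
inserted∈insertions ρ τ∈ with ∈-insertions⁻ ρ τ∈
... | as , bs , refl , refl = Anyₚ.++⁺ʳ as (here refl)

-- invB (x ∷ τ) is headInversions x τ + invB τ by definition.
headInversions : ℤ → List ℤ → ℕ
headInversions x τ = countᵇ (_<ᶻ x) τ + countᵇ (_<ᶻ - x) τ + indicator (x <ᶻ + 0)

sgn-headInversions-insertions : ∀ {x z} ρ {τ} → (z <ᶻ x) ≡ (z <ᶻ - x) → τ ∈ insertions z ρ →
                                sgn (headInversions x τ) ≡ sgn (headInversions x ρ)
sgn-headInversions-insertions {x} {z} ρ z<x≡z<-x τ∈ with ∈-insertions⁻ ρ τ∈
... | as , bs , refl , refl = begin
    sgn (countᵇ (_<ᶻ x) (as ++ z ∷ bs) + countᵇ (_<ᶻ - x) (as ++ z ∷ bs) + n₀)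
  ≡⟨ cong₂ (λ c c′ → sgn (c + c′ + n₀)) (countᵇ-insert (_<ᶻ x) as z bs)
       (trans (countᵇ-insert (_<ᶻ - x) as z bs) (cong (λ b → indicator b + c₂) (sym z<x≡z<-x))) ⟩
    sgn (d + c₁ + (d + c₂) + n₀)
  ≡⟨ cong sgn (regroup d c₁ c₂ n₀) ⟩
    sgn (d + d + (c₁ + c₂ + n₀))
  ≡⟨ sgn-double d _ ⟩
    sgn (c₁ + c₂ + n₀) ∎
  where
  open ≡-Reasoning
  d  = indicator (z <ᶻ x)
  c₁ = countᵇ (_<ᶻ x) (as ++ bs)
  c₂ = countᵇ (_<ᶻ - x) (as ++ bs)
  n₀ = indicator (x <ᶻ + 0)
  regroup : ∀ d c₁ c₂ n₀ → d + c₁ + (d + c₂) + n₀ ≡ d + d + (c₁ + c₂ + n₀)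
  regroup = ℕ-Solver.solve-∀

headInversions-top : ∀ {n w} → All (InRange (suc n)) w → headInversions (+ suc n) w ≡ length w
headInversions-top {n} {w} w∈ = begin
    countᵇ (_<ᶻ + suc n) w + countᵇ (_<ᶻ - + suc n) w + 0
  ≡⟨ cong₂ (λ c c′ → c + c′ + 0) (countᵇ-all _ (All.map InRange.<top w∈))
                                  (countᵇ-none _ (All.map InRange.≮bottom w∈)) ⟩
    length w + 0 + 0
  ≡⟨ ℕₚ.+-identityʳ _ ⟩
    length w + 0
  ≡⟨ ℕₚ.+-identityʳ _ ⟩
    length w ∎
  where open ≡-Reasoning

headInversions-bottom : ∀ {n w} → All (InRange (suc n)) w → headInversions (- + suc n) w ≡ suc (length w)
headInversions-bottom {n} {w} w∈ = begin
    countᵇ (_<ᶻ - + suc n) w + countᵇ (_<ᶻ + suc n) w + 1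
  ≡⟨ cong₂ (λ c c′ → c + c′ + 1) (countᵇ-none _ (All.map InRange.≮bottom w∈))
                                  (countᵇ-all _ (All.map InRange.<top w∈)) ⟩
    length w + 1
  ≡⟨ ℕₚ.+-comm (length w) 1 ⟩
    suc (length w) ∎
  where open ≡-Reasoning

-- Signed permutations by insertion

𝔅 : ℕ → List (List ℤ)
𝔅 zero    = [] ∷ []
𝔅 (suc n) = concatMap (insertions± (suc n)) (𝔅 n)

∈-insertions±⁻ : ∀ {N} ρ {τ} → τ ∈ insertions± N ρ →
                 ∃ λ z → (z ≡ + N ⊎ z ≡ - + N) × τ ∈ insertions z ρ
∈-insertions±⁻ {N} ρ τ∈ with ∈-++⁻ (insertions (+ N) ρ) τ∈
... | inj₁ τ∈⁺ = + N , inj₁ refl , τ∈⁺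
... | inj₂ τ∈⁻ = - + N , inj₂ refl , τ∈⁻

∈-𝔅-suc⁻ : ∀ {n σ} → σ ∈ 𝔅 (suc n) →
           ∃₂ λ ρ z → ρ ∈ 𝔅 n × (z ≡ + suc n ⊎ z ≡ - + suc n) × σ ∈ insertions z ρ
∈-𝔅-suc⁻ {n} σ∈ with find (∈-concatMap⁻ (insertions± (suc n)) {xs = 𝔅 n} σ∈)
... | ρ , ρ∈ , σ∈ρ± with ∈-insertions±⁻ ρ σ∈ρ±
... | z , z≡ , σ∈ρz = ρ , z , ρ∈ , z≡ , σ∈ρz

Admissible : ℕ → List ℤ → Set
Admissible N w = All (InRange N) w × Linked _≢_ w

𝔅-admissible : ∀ n {σ} → σ ∈ 𝔅 n → Admissible (suc n) (+ 0 ∷ σ)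
𝔅-admissible zero    (here refl) = 0-InRange ∷ [] , [-]
𝔅-admissible (suc n) σ∈ with ∈-𝔅-suc⁻ σ∈
... | ρ , z , ρ∈𝔅 , z≡ , σ∈ρz with 𝔅-admissible n ρ∈𝔅
... | 0∈ ∷ ρ-range , linked =
  InRange-suc 0∈ ∷ all-insertions (inRange z≡) (All.map InRange-suc ρ-range) σ∈ρz ,
  linked-insertions (fresh z≡) linked σ∈ρz
  where
  inRange : ∀ {z} → z ≡ + suc n ⊎ z ≡ - + suc n → InRange (suc (suc n)) z
  inRange (inj₁ refl) = ℤ.-<+ , ℤ.+<+ (ℕₚ.n<1+n (suc n))
  inRange (inj₂ refl) = ℤ.-<- (ℕₚ.n<1+n n) , ℤ.-<+
  fresh : ∀ {z} → z ≡ + suc n ⊎ z ≡ - + suc n → All (z ≢_) (+ 0 ∷ ρ)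
  fresh (inj₁ refl) = All.map (≢-sym ∘ InRange.≢top) (0∈ ∷ ρ-range)
  fresh (inj₂ refl) = All.map (≢-sym ∘ InRange.≢bottom) (0∈ ∷ ρ-range)

-- signedPerms n and 𝔅 n list the same words, each once

Letter : ℕ → ℤ → Set
Letter n y = 0 ℕ.< ℤ.∣ y ∣ × ℤ.∣ y ∣ ℕ.≤ n

Covers : ℕ → List ℤ → Set
Covers n w = ∀ {j} → j ℕ.< n → Any (λ y → ℤ.∣ y ∣ ≡ suc j) w

SignedPerm : ℕ → List ℤ → Set
SignedPerm n w = length w ≡ n × All (Letter n) w × Covers n w

signedPair : ℕ → List ℤ
signedPair j = + suc j ∷ - + suc j ∷ []

∈-signedPair : ∀ {j y} → y ∈ signedPair j → ℤ.∣ y ∣ ≡ suc j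
∈-signedPair (here refl)         = refl
∈-signedPair (there (here refl)) = refl

Letter⇒∈letters : ∀ {n y} → Letter n y → y ∈ letters n
Letter⇒∈letters {n} {+ suc j}    (_ , j<n) =
  ∈-concatMap⁺ signedPair {xs = upTo n} (lose (∈-upTo⁺ j<n) (here refl))
Letter⇒∈letters {n} { -[1+ j ]} (_ , j<n) =
  ∈-concatMap⁺ signedPair {xs = upTo n} (lose (∈-upTo⁺ j<n) (there (here refl)))

∈letters⇒Letter : ∀ {n y} → y ∈ letters n → Letter n y
∈letters⇒Letter {n} y∈ with find (∈-concatMap⁻ signedPair {xs = upTo n} y∈)
... | j , j∈ , y∈pair rewrite ∈-signedPair y∈pair = ℕ.s≤s ℕ.z≤n , ∈-upTo⁻ j∈

Unique-letters : ∀ n → Unique (letters n)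
Unique-letters n = Unique-concatMap⁺ signedPair (Uniqueₚ.upTo⁺ n) (λ _ → ((λ ()) ∷ []) ∷ [] ∷ [])
  (λ _ _ y∈ y∈′ → ℕₚ.suc-injective (trans (sym (∈-signedPair y∈)) (∈-signedPair y∈′)))

∈-words⁻ : ∀ n m {w} → w ∈ words n m → length w ≡ m × All (_∈ letters n) w
∈-words⁻ n zero    (here refl) = refl , []
∈-words⁻ n (suc m) w∈ with find (∈-concatMap⁻ (λ w → map (_∷ w) (letters n)) {xs = words n m} w∈)
... | w′ , w′∈ , w∈ys with ∈-map⁻ (_∷ w′) w∈ys | ∈-words⁻ n m w′∈
... | y , y∈ , refl | len , w′-letters = cong suc len , y∈ ∷ w′-letters

∈-words⁺ : ∀ n {w} → All (_∈ letters n) w → w ∈ words n (length w)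
∈-words⁺ n []                 = here refl
∈-words⁺ n {y ∷ w} (y∈ ∷ w∈) =
  ∈-concatMap⁺ (λ w → map (_∷ w) (letters n)) {xs = words n (length w)}
               (lose (∈-words⁺ n w∈) (∈-map⁺ (_∷ w) y∈))

Unique-words : ∀ n m → Unique (words n m)
Unique-words n zero    = [] ∷ []
Unique-words n (suc m) = Unique-concatMap⁺ (λ w → map (_∷ w) (letters n)) (Unique-words n m)
  (λ _ → Uniqueₚ.map⁺ Listₚ.∷-injectiveˡ (Unique-letters n)) sameTail
  where
  sameTail : ∀ {w w′ v} → w ∈ words n m → w′ ∈ words n m →
             v ∈ map (_∷ w) (letters n) → v ∈ map (_∷ w′) (letters n) → w ≡ w′
  sameTail _ _ v∈ v∈′ with ∈-map⁻ (_∷ _) v∈ | ∈-map⁻ (_∷ _) v∈′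
  ... | _ , _ , refl | _ , _ , v≡ = Listₚ.∷-injectiveʳ v≡

isSignedPerm⇒Covers : ∀ n w → T (isSignedPerm n w) → Covers n w
isSignedPerm⇒Covers n w t j<n =
  Any.map (λ {y} → ℕₚ.≡ᵇ⇒≡ ℤ.∣ y ∣ _) (Anyₚ.any⁻ _ w (All.lookup (Allₚ.all⁺ _ (upTo n) t) (∈-upTo⁺ j<n)))

Covers⇒isSignedPerm : ∀ n w → Covers n w → T (isSignedPerm n w)
Covers⇒isSignedPerm n w covers = Allₚ.all⁻ _ (All.tabulate λ j∈ →
  Anyₚ.any⁺ _ (Any.map (λ {y} → ℕₚ.≡⇒≡ᵇ ℤ.∣ y ∣ _) (covers (∈-upTo⁻ j∈))))

∈-signedPerms⁻ : ∀ n {w} → w ∈ signedPerms n → SignedPerm n w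
∈-signedPerms⁻ n {w} w∈ with ∈-filter⁻ (T? ∘ isSignedPerm n) {xs = words n n} w∈
... | w∈words , t with ∈-words⁻ n n w∈words
... | len , w-letters = len , All.map ∈letters⇒Letter w-letters , isSignedPerm⇒Covers n w t

∈-signedPerms⁺ : ∀ n {w} → SignedPerm n w → w ∈ signedPerms n
∈-signedPerms⁺ n {w} (refl , w-letters , covers) =
  ∈-filter⁺ (T? ∘ isSignedPerm n) (∈-words⁺ n (All.map Letter⇒∈letters w-letters))
            (Covers⇒isSignedPerm n w covers)

Unique-signedPerms : ∀ n → Unique (signedPerms n)
Unique-signedPerms n = Uniqueₚ.filter⁺ (T? ∘ isSignedPerm n) (Unique-words n n)

Letter-suc : ∀ {n y} → Letter n y → Letter (suc n) y
Letter-suc (0<∣y∣ , ∣y∣≤n) = 0<∣y∣ , ℕₚ.m≤n⇒m≤1+n ∣y∣≤n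

removeLargest : ∀ n {σ} → length σ ≡ suc n → Covers (suc n) σ →
  ∃₂ λ as bs → ∃ λ x → σ ≡ as ++ x ∷ bs × ℤ.∣ x ∣ ≡ suc n × length (as ++ bs) ≡ n × Covers n (as ++ bs)
removeLargest n len covers with find (covers (ℕₚ.n<1+n n))
... | x , x∈σ , ∣x∣≡ with ∈-∃++ x∈σ
... | as , bs , refl =
  as , bs , x , refl , ∣x∣≡ , ℕₚ.suc-injective (trans (sym (Listₚ.length-++-sucʳ as x bs)) len) ,
  λ j<n → any-remove as (covers (ℕₚ.m<n⇒m<1+n j<n))
                        (λ ∣x∣≡j → ℕₚ.<⇒≢ j<n (ℕₚ.suc-injective (trans (sym ∣x∣≡j) ∣x∣≡)))

covering⇒bounded : ∀ n {w} → length w ≡ n → Covers n w → All (λ y → ℤ.∣ y ∣ ℕ.≤ n) w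
covering⇒bounded zero    {[]} _ _ = []
covering⇒bounded (suc n) len covers with removeLargest n len covers
... | as , bs , x , refl , ∣x∣≡ , len′ , covers′ =
  all-insert as (All.map ℕₚ.m≤n⇒m≤1+n (covering⇒bounded n len′ covers′)) (ℕₚ.≤-reflexive ∣x∣≡)

∈-𝔅⁻ : ∀ n {σ} → σ ∈ 𝔅 n → SignedPerm n σ
∈-𝔅⁻ zero    (here refl) = refl , [] , λ ()
∈-𝔅⁻ (suc n) σ∈ with ∈-𝔅-suc⁻ σ∈
... | ρ , z , ρ∈ , z≡ , σ∈ρz with ∈-𝔅⁻ n ρ∈ | ∈-insertions⁻ ρ σ∈ρz
... | len , ρ-letters , covers | as , bs , refl , refl =
  trans (Listₚ.length-++-sucʳ as z bs) (cong suc len) ,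
  all-insert as (All.map (λ {y} → Letter-suc {n} {y}) ρ-letters)
    (subst (λ k → 0 ℕ.< k × k ℕ.≤ suc n) (sym (±-abs z≡)) (ℕ.s≤s ℕ.z≤n , ℕₚ.≤-refl)) ,
  coversInsert
  where
  coversInsert : Covers (suc n) (as ++ z ∷ bs)
  coversInsert j<1+n with ℕₚ.m<1+n⇒m<n∨m≡n j<1+n
  ... | inj₁ j<n  = any-insert as (covers j<n)
  ... | inj₂ refl = Anyₚ.++⁺ʳ as (here (±-abs z≡))

∈-𝔅⁺ : ∀ n {σ} → SignedPerm n σ → σ ∈ 𝔅 n
∈-𝔅⁺ zero    {[]} _ = here refl
∈-𝔅⁺ (suc n) (len , σ-letters , covers) with removeLargest n len covers
... | as , bs , x , refl , ∣x∣≡ , len′ , covers′ =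
  ∈-concatMap⁺ (insertions± (suc n)) {xs = 𝔅 n}
    (lose (∈-𝔅⁺ n (len′ , ρ-letters , covers′)) (inserted (abs-± x ∣x∣≡)))
  where
  ρ-letters : All (Letter n) (as ++ bs)
  ρ-letters = All.zipWith (λ (l , ∣y∣≤n) → proj₁ l , ∣y∣≤n)
                          (all-remove as σ-letters , covering⇒bounded n len′ covers′)
  inserted : ∀ {y} → y ≡ + suc n ⊎ y ≡ - + suc n → as ++ y ∷ bs ∈ insertions± (suc n) (as ++ bs)
  inserted (inj₁ refl) = ∈-++⁺ˡ (∈-insertions⁺ as _ bs)
  inserted (inj₂ refl) = ∈-++⁺ʳ (insertions (+ suc n) (as ++ bs)) (∈-insertions⁺ as _ bs)

eraseAbs : ℕ → List ℤ → List ℤ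
eraseAbs N = filter (λ y → ¬? (ℤ.∣ y ∣ ℕ.≟ N))

eraseAbs-insert : ∀ {N} as z bs → ℤ.∣ z ∣ ≡ N → All (λ y → ℤ.∣ y ∣ ≢ N) (as ++ bs) →
                  eraseAbs N (as ++ z ∷ bs) ≡ as ++ bs
eraseAbs-insert {N} as z bs ∣z∣≡ others = begin
    eraseAbs N (as ++ z ∷ bs)
  ≡⟨ Listₚ.filter-++ keep? as (z ∷ bs) ⟩
    eraseAbs N as ++ eraseAbs N (z ∷ bs)
  ≡⟨ cong₂ _++_ (Listₚ.filter-all keep? (Allₚ.++⁻ˡ as others))
                (trans (Listₚ.filter-reject keep? {z} {bs} (λ ∣z∣≢ → ∣z∣≢ ∣z∣≡))
                       (Listₚ.filter-all keep? (Allₚ.++⁻ʳ as others))) ⟩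
    as ++ bs ∎
  where
  open ≡-Reasoning
  keep? = λ y → ¬? (ℤ.∣ y ∣ ℕ.≟ N)

Unique-insertions : ∀ {z} ρ → All (z ≢_) ρ → Unique (insertions z ρ)
Unique-insertions []       _           = [] ∷ []
Unique-insertions {z} (y ∷ ys) (z≢y ∷ z∉ys) =
  All.tabulate headDiffers ∷ Uniqueₚ.map⁺ Listₚ.∷-injectiveʳ (Unique-insertions ys z∉ys)
  where
  headDiffers : ∀ {τ} → τ ∈ map (y ∷_) (insertions z ys) → z ∷ y ∷ ys ≢ τ
  headDiffers τ∈ eq with ∈-map⁻ (y ∷_) τ∈
  ... | _ , _ , refl = z≢y (Listₚ.∷-injectiveˡ eq)

Unique-𝔅 : ∀ n → Unique (𝔅 n)
Unique-𝔅 zero    = [] ∷ []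
Unique-𝔅 (suc n) = Unique-concatMap⁺ (insertions± (suc n)) (Unique-𝔅 n) uniqueBlock sameOrigin
  where
  below : ∀ {ρ} → ρ ∈ 𝔅 n → All (λ y → ℤ.∣ y ∣ ≢ suc n) ρ
  below ρ∈ = All.map (λ l → ℕₚ.<⇒≢ (ℕ.s≤s (proj₂ l))) (proj₁ (proj₂ (∈-𝔅⁻ n ρ∈)))
  fresh : ∀ {ρ z} → ρ ∈ 𝔅 n → ℤ.∣ z ∣ ≡ suc n → All (z ≢_) ρ
  fresh ρ∈ ∣z∣≡ = All.map (λ ∣y∣≢ z≡y → ∣y∣≢ (trans (cong ℤ.∣_∣ (sym z≡y)) ∣z∣≡)) (below ρ∈)
  uniqueBlock : ∀ {ρ} → ρ ∈ 𝔅 n → Unique (insertions± (suc n) ρ)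
  uniqueBlock {ρ} ρ∈ =
    Uniqueₚ.++⁺ (Unique-insertions ρ (fresh ρ∈ refl)) (Unique-insertions ρ (fresh ρ∈ refl)) disjoint
    where
    disjoint : ∀ {τ} → τ ∈ insertions (+ suc n) ρ × τ ∈ insertions (- + suc n) ρ → ⊥
    disjoint (τ∈⁺ , τ∈⁻) =
      All.lookup (all-insertions (λ ()) (All.map ≢-sym (fresh ρ∈ refl)) τ∈⁺) (inserted∈insertions ρ τ∈⁻) refl
  erase : ∀ {ρ τ} → ρ ∈ 𝔅 n → τ ∈ insertions± (suc n) ρ → eraseAbs (suc n) τ ≡ ρ
  erase {ρ} ρ∈ τ∈ with ∈-insertions±⁻ ρ τ∈
  ... | z , z≡ , τ∈z with ∈-insertions⁻ ρ τ∈z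
  ... | as , bs , refl , refl = eraseAbs-insert as z bs (±-abs z≡) (below ρ∈)
  sameOrigin : ∀ {ρ ρ′ τ} → ρ ∈ 𝔅 n → ρ′ ∈ 𝔅 n →
               τ ∈ insertions± (suc n) ρ → τ ∈ insertions± (suc n) ρ′ → ρ ≡ ρ′
  sameOrigin ρ∈ ρ′∈ τ∈ τ∈′ = trans (sym (erase ρ∈ τ∈)) (erase ρ′∈ τ∈′)

signedPerms↭𝔅 : ∀ n → signedPerms n ↭ 𝔅 n
signedPerms↭𝔅 n = ∼bag⇒↭ (unique∧set⇒bag (Unique-signedPerms n) (Unique-𝔅 n)
  (mk⇔ (∈-𝔅⁺ n ∘ ∈-signedPerms⁻ n) (∈-signedPerms⁺ n ∘ ∈-𝔅⁻ n)))

-- Ring identities behind the transfer tables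

scale-base : ∀ A B s₁ s₂ p q D T V →
  A *ℤ (s₁ *ℤ p) +ℤ B *ℤ (s₂ *ℤ q) +ℤ D ≡ T →
  A *ℤ (s₁ *ℤ (p *ℤ V)) +ℤ B *ℤ (s₂ *ℤ (q *ℤ V)) +ℤ V *ℤ D ≡ T *ℤ V
scale-base A B s₁ s₂ p q D T V eq =
  trans (factor A B s₁ s₂ p q D V) (cong (_*ℤ V) eq)
  where
  factor : ∀ A B s₁ s₂ p q D V →
    A *ℤ (s₁ *ℤ (p *ℤ V)) +ℤ B *ℤ (s₂ *ℤ (q *ℤ V)) +ℤ V *ℤ D ≡ (A *ℤ (s₁ *ℤ p) +ℤ B *ℤ (s₂ *ℤ q) +ℤ D) *ℤ V
  factor = solve-∀

scale-step : ∀ A B s₁ s₂ p q X Y Z D T S V →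
  A *ℤ (s₁ *ℤ (p *ℤ X)) +ℤ B *ℤ (s₂ *ℤ (q *ℤ Y)) +ℤ D ≡ T *ℤ Z →
  A *ℤ (s₁ *ℤ (p *ℤ (S *ℤ (X *ℤ V)))) +ℤ B *ℤ (s₂ *ℤ (q *ℤ (S *ℤ (Y *ℤ V)))) +ℤ S *ℤ (D *ℤ V)
    ≡ T *ℤ (S *ℤ (Z *ℤ V))
scale-step A B s₁ s₂ p q X Y Z D T S V eq =
  trans (factor A B s₁ s₂ p q X Y D S V) (trans (cong (_*ℤ (S *ℤ V)) eq) (unfactor T Z S V))
  where
  factor : ∀ A B s₁ s₂ p q X Y D S V →
    A *ℤ (s₁ *ℤ (p *ℤ (S *ℤ (X *ℤ V)))) +ℤ B *ℤ (s₂ *ℤ (q *ℤ (S *ℤ (Y *ℤ V)))) +ℤ S *ℤ (D *ℤ V)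
      ≡ (A *ℤ (s₁ *ℤ (p *ℤ X)) +ℤ B *ℤ (s₂ *ℤ (q *ℤ Y)) +ℤ D) *ℤ (S *ℤ V)
  factor = solve-∀
  unfactor : ∀ T Z S V → T *ℤ Z *ℤ (S *ℤ V) ≡ T *ℤ (S *ℤ (Z *ℤ V))
  unfactor = solve-∀

-- One identity for each parity and each value of the Boolean arguments of transferBase,
-- transferStep and closedForm-transfer, with gᵢⱼ standing for g i j (1 = true, 0 = false).  Each is
-- stated in the shape obtained by unfolding turn, peel and the tables, so that it applies as is.

oddBase-T : ∀ p q g₁₁ g₁₀ g₀₁ g₀₀ →
  g₁₀ *ℤ (-1ℤ *ℤ p) +ℤ g₀₁ *ℤ (1ℤ *ℤ q) +ℤ (g₁₁ *ℤ 1ℤ - g₁₀ *ℤ p)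
    ≡ g₁₁ - + 2 *ℤ p *ℤ g₁₀ +ℤ q *ℤ g₀₁
oddBase-T = solve-∀

oddBase-F : ∀ p q g₁₁ g₁₀ g₀₁ g₀₀ →
  g₁₀ *ℤ (-1ℤ *ℤ p) +ℤ g₀₁ *ℤ (1ℤ *ℤ q) +ℤ (g₀₁ *ℤ q - g₀₀ *ℤ 1ℤ)
    ≡ + 2 *ℤ q *ℤ g₀₁ - p *ℤ g₁₀ - g₀₀
oddBase-F = solve-∀

oddStep-TTT : ∀ p q g₁₁ g₁₀ g₀₁ g₀₀ →
  g₁₁ *ℤ (-1ℤ *ℤ (p *ℤ q))
  +ℤ g₀₁ *ℤ (1ℤ *ℤ (q *ℤ 1ℤ))
  +ℤ ((1ℤ +ℤ + 2 *ℤ p *ℤ q) *ℤ (g₁₁ *ℤ 1ℤ) - + 2 *ℤ p *ℤ (g₁₀ *ℤ 1ℤ) - q *ℤ (g₁₁ *ℤ p))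
    ≡ (g₁₁ - + 2 *ℤ p *ℤ g₁₀ +ℤ q *ℤ g₀₁) *ℤ 1ℤ
oddStep-TTT = solve-∀

oddStep-TTF : ∀ p q g₁₁ g₁₀ g₀₁ g₀₀ →
  g₁₀ *ℤ (-1ℤ *ℤ (p *ℤ q))
  +ℤ g₀₀ *ℤ (1ℤ *ℤ (q *ℤ 1ℤ))
  +ℤ (+ 2 *ℤ q *ℤ (g₁₁ *ℤ 1ℤ) - g₁₀ *ℤ 1ℤ - q *ℤ (g₁₀ *ℤ p))
    ≡ (+ 2 *ℤ q *ℤ g₁₁ - (1ℤ +ℤ + 2 *ℤ p *ℤ q) *ℤ g₁₀ +ℤ q *ℤ g₀₀) *ℤ 1ℤ
oddStep-TTF = solve-∀

oddStep-TFT : ∀ p q g₁₁ g₁₀ g₀₁ g₀₀ →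
  g₁₁ *ℤ (-1ℤ *ℤ (p *ℤ 1ℤ))
  +ℤ g₀₁ *ℤ (1ℤ *ℤ (q *ℤ p))
  +ℤ (p *ℤ (g₁₁ *ℤ 1ℤ) +ℤ g₁₁ *ℤ p - + 2 *ℤ p *ℤ (g₁₀ *ℤ p))
    ≡ (g₁₁ - + 2 *ℤ p *ℤ g₁₀ +ℤ q *ℤ g₀₁) *ℤ p
oddStep-TFT = solve-∀

oddStep-TFF : ∀ p q g₁₁ g₁₀ g₀₁ g₀₀ →
  g₁₀ *ℤ (-1ℤ *ℤ (p *ℤ 1ℤ))
  +ℤ g₀₀ *ℤ (1ℤ *ℤ (q *ℤ p))
  +ℤ (p *ℤ (g₁₀ *ℤ 1ℤ) +ℤ + 2 *ℤ q *ℤ (g₁₁ *ℤ p) - (1ℤ +ℤ + 2 *ℤ p *ℤ q) *ℤ (g₁₀ *ℤ p))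
    ≡ (+ 2 *ℤ q *ℤ g₁₁ - (1ℤ +ℤ + 2 *ℤ p *ℤ q) *ℤ g₁₀ +ℤ q *ℤ g₀₀) *ℤ p
oddStep-TFF = solve-∀

oddStep-FTT : ∀ p q g₁₁ g₁₀ g₀₁ g₀₀ →
  g₁₁ *ℤ (-1ℤ *ℤ (p *ℤ q))
  +ℤ g₀₁ *ℤ (1ℤ *ℤ (q *ℤ 1ℤ))
  +ℤ ((1ℤ +ℤ + 2 *ℤ p *ℤ q) *ℤ (g₀₁ *ℤ q) - + 2 *ℤ p *ℤ (g₀₀ *ℤ q) - q *ℤ (g₀₁ *ℤ 1ℤ))
    ≡ ((1ℤ +ℤ + 2 *ℤ p *ℤ q) *ℤ g₀₁ - p *ℤ g₁₁ - + 2 *ℤ p *ℤ g₀₀) *ℤ q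
oddStep-FTT = solve-∀

oddStep-FTF : ∀ p q g₁₁ g₁₀ g₀₁ g₀₀ →
  g₁₀ *ℤ (-1ℤ *ℤ (p *ℤ q))
  +ℤ g₀₀ *ℤ (1ℤ *ℤ (q *ℤ 1ℤ))
  +ℤ (+ 2 *ℤ q *ℤ (g₀₁ *ℤ q) - g₀₀ *ℤ q - q *ℤ (g₀₀ *ℤ 1ℤ))
    ≡ (+ 2 *ℤ q *ℤ g₀₁ - p *ℤ g₁₀ - g₀₀) *ℤ q
oddStep-FTF = solve-∀

oddStep-FFT : ∀ p q g₁₁ g₁₀ g₀₁ g₀₀ →
  g₁₁ *ℤ (-1ℤ *ℤ (p *ℤ 1ℤ))
  +ℤ g₀₁ *ℤ (1ℤ *ℤ (q *ℤ p))
  +ℤ (p *ℤ (g₀₁ *ℤ q) +ℤ g₀₁ *ℤ 1ℤ - + 2 *ℤ p *ℤ (g₀₀ *ℤ 1ℤ))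
    ≡ ((1ℤ +ℤ + 2 *ℤ p *ℤ q) *ℤ g₀₁ - p *ℤ g₁₁ - + 2 *ℤ p *ℤ g₀₀) *ℤ 1ℤ
oddStep-FFT = solve-∀

oddStep-FFF : ∀ p q g₁₁ g₁₀ g₀₁ g₀₀ →
  g₁₀ *ℤ (-1ℤ *ℤ (p *ℤ 1ℤ))
  +ℤ g₀₀ *ℤ (1ℤ *ℤ (q *ℤ p))
  +ℤ (p *ℤ (g₀₀ *ℤ q) +ℤ + 2 *ℤ q *ℤ (g₀₁ *ℤ 1ℤ) - (1ℤ +ℤ + 2 *ℤ p *ℤ q) *ℤ (g₀₀ *ℤ 1ℤ))
    ≡ (+ 2 *ℤ q *ℤ g₀₁ - p *ℤ g₁₀ - g₀₀) *ℤ 1ℤ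
oddStep-FFF = solve-∀

evenStep-TTT : ∀ p q g₁₁ g₁₀ g₀₁ g₀₀ →
  g₁₁ *ℤ (1ℤ *ℤ (p *ℤ q))
  +ℤ g₀₁ *ℤ (-1ℤ *ℤ (q *ℤ 1ℤ))
  +ℤ (g₁₁ *ℤ 1ℤ - + 2 *ℤ p *ℤ (g₁₀ *ℤ 1ℤ) +ℤ q *ℤ (g₁₁ *ℤ p))
    ≡ ((1ℤ +ℤ + 2 *ℤ p *ℤ q) *ℤ g₁₁ - + 2 *ℤ p *ℤ g₁₀ - q *ℤ g₀₁) *ℤ 1ℤ
evenStep-TTT = solve-∀

evenStep-TTF : ∀ p q g₁₁ g₁₀ g₀₁ g₀₀ →
  g₁₀ *ℤ (1ℤ *ℤ (p *ℤ q))
  +ℤ g₀₀ *ℤ (-1ℤ *ℤ (q *ℤ 1ℤ))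
  +ℤ (+ 2 *ℤ q *ℤ (g₁₁ *ℤ 1ℤ) - (1ℤ +ℤ + 2 *ℤ p *ℤ q) *ℤ (g₁₀ *ℤ 1ℤ) +ℤ q *ℤ (g₁₀ *ℤ p))
    ≡ (+ 2 *ℤ q *ℤ g₁₁ - g₁₀ - q *ℤ g₀₀) *ℤ 1ℤ
evenStep-TTF = solve-∀

evenStep-TFT : ∀ p q g₁₁ g₁₀ g₀₁ g₀₀ →
  g₁₁ *ℤ (1ℤ *ℤ (p *ℤ 1ℤ))
  +ℤ g₀₁ *ℤ (-1ℤ *ℤ (q *ℤ p))
  +ℤ ((1ℤ +ℤ + 2 *ℤ p *ℤ q) *ℤ (g₁₁ *ℤ p) - p *ℤ (g₁₁ *ℤ 1ℤ) - + 2 *ℤ p *ℤ (g₁₀ *ℤ p))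
    ≡ ((1ℤ +ℤ + 2 *ℤ p *ℤ q) *ℤ g₁₁ - + 2 *ℤ p *ℤ g₁₀ - q *ℤ g₀₁) *ℤ p
evenStep-TFT = solve-∀

evenStep-TFF : ∀ p q g₁₁ g₁₀ g₀₁ g₀₀ →
  g₁₀ *ℤ (1ℤ *ℤ (p *ℤ 1ℤ))
  +ℤ g₀₀ *ℤ (-1ℤ *ℤ (q *ℤ p))
  +ℤ (+ 2 *ℤ q *ℤ (g₁₁ *ℤ p) - p *ℤ (g₁₀ *ℤ 1ℤ) - g₁₀ *ℤ p)
    ≡ (+ 2 *ℤ q *ℤ g₁₁ - g₁₀ - q *ℤ g₀₀) *ℤ p
evenStep-TFF = solve-∀

evenStep-FTT : ∀ p q g₁₁ g₁₀ g₀₁ g₀₀ →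
  g₁₁ *ℤ (1ℤ *ℤ (p *ℤ q))
  +ℤ g₀₁ *ℤ (-1ℤ *ℤ (q *ℤ 1ℤ))
  +ℤ (g₀₁ *ℤ q - + 2 *ℤ p *ℤ (g₀₀ *ℤ q) +ℤ q *ℤ (g₀₁ *ℤ 1ℤ))
    ≡ (p *ℤ g₁₁ +ℤ g₀₁ - + 2 *ℤ p *ℤ g₀₀) *ℤ q
evenStep-FTT = solve-∀

evenStep-FTF : ∀ p q g₁₁ g₁₀ g₀₁ g₀₀ →
  g₁₀ *ℤ (1ℤ *ℤ (p *ℤ q))
  +ℤ g₀₀ *ℤ (-1ℤ *ℤ (q *ℤ 1ℤ))
  +ℤ (+ 2 *ℤ q *ℤ (g₀₁ *ℤ q) - (1ℤ +ℤ + 2 *ℤ p *ℤ q) *ℤ (g₀₀ *ℤ q) +ℤ q *ℤ (g₀₀ *ℤ 1ℤ))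
    ≡ (p *ℤ g₁₀ +ℤ + 2 *ℤ q *ℤ g₀₁ - (1ℤ +ℤ + 2 *ℤ p *ℤ q) *ℤ g₀₀) *ℤ q
evenStep-FTF = solve-∀

evenStep-FFT : ∀ p q g₁₁ g₁₀ g₀₁ g₀₀ →
  g₁₁ *ℤ (1ℤ *ℤ (p *ℤ 1ℤ))
  +ℤ g₀₁ *ℤ (-1ℤ *ℤ (q *ℤ p))
  +ℤ ((1ℤ +ℤ + 2 *ℤ p *ℤ q) *ℤ (g₀₁ *ℤ 1ℤ) - p *ℤ (g₀₁ *ℤ q) - + 2 *ℤ p *ℤ (g₀₀ *ℤ 1ℤ))
    ≡ (p *ℤ g₁₁ +ℤ g₀₁ - + 2 *ℤ p *ℤ g₀₀) *ℤ 1ℤ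
evenStep-FFT = solve-∀

evenStep-FFF : ∀ p q g₁₁ g₁₀ g₀₁ g₀₀ →
  g₁₀ *ℤ (1ℤ *ℤ (p *ℤ 1ℤ))
  +ℤ g₀₀ *ℤ (-1ℤ *ℤ (q *ℤ p))
  +ℤ (+ 2 *ℤ q *ℤ (g₀₁ *ℤ 1ℤ) - p *ℤ (g₀₀ *ℤ q) - g₀₀ *ℤ 1ℤ)
    ≡ (p *ℤ g₁₀ +ℤ + 2 *ℤ q *ℤ g₀₁ - (1ℤ +ℤ + 2 *ℤ p *ℤ q) *ℤ g₀₀) *ℤ 1ℤ
evenStep-FFF = solve-∀

closed-odd : ∀ p q g₁₁ g₁₀ g₀₁ g₀₀ →
  g₁₁ +ℤ g₀₀ - q *ℤ g₀₁ - p *ℤ g₁₀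
    ≡ g₁₁ - + 2 *ℤ p *ℤ g₁₀ +ℤ q *ℤ g₀₁ - (+ 2 *ℤ q *ℤ g₀₁ - p *ℤ g₁₀ - g₀₀)
closed-odd = solve-∀

closed-even : ∀ p q g₁₁ g₁₀ g₀₁ g₀₀ →
  (1ℤ - p *ℤ q) *ℤ (g₁₁ - g₀₀)
    ≡ (1ℤ +ℤ + 2 *ℤ p *ℤ q) *ℤ g₁₁
    - + 2 *ℤ p *ℤ g₁₀
    - q *ℤ g₀₁
    +ℤ (p *ℤ g₁₀ +ℤ + 2 *ℤ q *ℤ g₀₁ - (1ℤ +ℤ + 2 *ℤ p *ℤ q) *ℤ g₀₀)
    - q *ℤ (p *ℤ g₁₁ +ℤ g₀₁ - + 2 *ℤ p *ℤ g₀₀)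
    - p *ℤ (+ 2 *ℤ q *ℤ g₁₁ - g₁₀ - q *ℤ g₀₀)
closed-even = solve-∀

-- Weights and the transfer lemma

module Weights (p q : ℤ) where

  isPeak isValley : ℤ → ℤ → ℤ → Bool
  isPeak   a b c = (a <ᶻ b) ∧ (c <ᶻ b)
  isValley a b c = (b <ᶻ a) ∧ (b <ᶻ c)

  -- weightAfter (+ 0) is weight p q; other first letters arise in the induction along a word.
  weightAfter : ℤ → List ℤ → ℤ
  weightAfter a w =
    sgn (invB w) *ℤ p ^ℤ countTriples isPeak (a ∷ w) *ℤ q ^ℤ countTriples isValley (a ∷ w)

  -- The factor of a letter entered by a step that ascends iff b and left by one that ascends iff f.
  turn : Bool → Bool → ℤ
  turn true  false = p
  turn false true  = q
  turn _     _     = 1ℤ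

  turn-powers : ∀ b f → p ^ℤ indicator (b ∧ not f) *ℤ q ^ℤ indicator (not b ∧ f) ≡ turn b f
  turn-powers true  true  = refl
  turn-powers true  false = trans (ℤₚ.*-identityʳ _) (ℤₚ.*-identityʳ p)
  turn-powers false true  = trans (ℤₚ.*-identityˡ _) (ℤₚ.*-identityʳ q)
  turn-powers false false = refl

  weightAfter-∷∷ : ∀ a x t τ → a ≢ x → x ≢ t →
    weightAfter a (x ∷ t ∷ τ)
      ≡ sgn (headInversions x (t ∷ τ)) *ℤ (turn (a <ᶻ x) (x <ᶻ t) *ℤ weightAfter x (t ∷ τ))
  weightAfter-∷∷ a x t τ a≢x x≢t = begin
      weightAfter a (x ∷ t ∷ τ)
    ≡⟨ cong₂ _*ℤ_ (cong₂ _*ℤ_ (sgn-+ h i) (ℤₚ.^-distribˡ-+-* p iₚ cₚ)) (ℤₚ.^-distribˡ-+-* q iᵥ cᵥ) ⟩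
      sgn h *ℤ sgn i *ℤ (p ^ℤ iₚ *ℤ p ^ℤ cₚ) *ℤ (q ^ℤ iᵥ *ℤ q ^ℤ cᵥ)
    ≡⟨ regroup (sgn h) (sgn i) (p ^ℤ iₚ) (p ^ℤ cₚ) (q ^ℤ iᵥ) (q ^ℤ cᵥ) ⟩
      sgn h *ℤ (p ^ℤ iₚ *ℤ q ^ℤ iᵥ *ℤ weightAfter x (t ∷ τ))
    ≡⟨ cong (λ c → sgn h *ℤ (c *ℤ weightAfter x (t ∷ τ))) turnFactor ⟩
      sgn h *ℤ (turn (a <ᶻ x) (x <ᶻ t) *ℤ weightAfter x (t ∷ τ)) ∎
    where
    open ≡-Reasoning
    h  = headInversions x (t ∷ τ)
    i  = invB (t ∷ τ)
    iₚ = indicator (isPeak a x t)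
    iᵥ = indicator (isValley a x t)
    cₚ = countTriples isPeak (x ∷ t ∷ τ)
    cᵥ = countTriples isValley (x ∷ t ∷ τ)
    regroup : ∀ s s′ P P′ Q Q′ → s *ℤ s′ *ℤ (P *ℤ P′) *ℤ (Q *ℤ Q′) ≡ s *ℤ (P *ℤ Q *ℤ (s′ *ℤ P′ *ℤ Q′))
    regroup = solve-∀
    turnFactor : p ^ℤ iₚ *ℤ q ^ℤ iᵥ ≡ turn (a <ᶻ x) (x <ᶻ t)
    turnFactor = trans
      (cong₂ (λ t<x x<a → p ^ℤ indicator ((a <ᶻ x) ∧ t<x) *ℤ q ^ℤ indicator (x<a ∧ (x <ᶻ t)))
             (<ᶻ-flip x≢t) (<ᶻ-flip a≢x))
      (turn-powers (a <ᶻ x) (x <ᶻ t))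

  weightAfter-[-] : ∀ a x → weightAfter a (x ∷ []) ≡ sgn (headInversions x [])
  weightAfter-[-] a x =
    trans (ℤₚ.*-identityʳ (sgn (h + 0) *ℤ 1ℤ))
          (trans (ℤₚ.*-identityʳ (sgn (h + 0))) (cong sgn (ℕₚ.+-identityʳ h)))
    where h = headInversions x []

  -- g (first step ascending) (last step ascending)
  Boundary : Set
  Boundary = Bool → Bool → ℤ

  firstAscent : ℤ → List ℤ → Bool
  firstAscent a []      = false
  firstAscent a (x ∷ _) = a <ᶻ x

  lastAscent : ℤ → List ℤ → Bool
  lastAscent a w = lastTwo _<ᶻ_ (a ∷ w)

  weightWith : Boundary → ℤ → List ℤ → ℤ
  weightWith g a w = g (firstAscent a w) (lastAscent a w) *ℤ weightAfter a w

  -- The boundary weight seen from the second letter, when the first step is b: the turn made at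
  -- the first letter is absorbed into it.
  peel : Bool → Boundary → Boundary
  peel b g f e = g b e *ℤ turn b f

  weightWith-peel : ∀ g a x t τ → a ≢ x → x ≢ t →
    weightWith g a (x ∷ t ∷ τ)
      ≡ sgn (headInversions x (t ∷ τ)) *ℤ weightWith (peel (a <ᶻ x) g) x (t ∷ τ)
  weightWith-peel g a x t τ a≢x x≢t =
    trans (cong (g (a <ᶻ x) (lastAscent x (t ∷ τ)) *ℤ_) (weightAfter-∷∷ a x t τ a≢x x≢t))
          (regroup (g (a <ᶻ x) (lastAscent x (t ∷ τ))) (sgn (headInversions x (t ∷ τ)))
                   (turn (a <ᶻ x) (x <ᶻ t)) (weightAfter x (t ∷ τ)))
    where
    regroup : ∀ G S T W → G *ℤ (S *ℤ (T *ℤ W)) ≡ S *ℤ (G *ℤ T *ℤ W)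
    regroup = solve-∀

  insertionSum : ℕ → Boundary → ℤ → List ℤ → ℤ
  insertionSum N g a σ = sumℤ (map (weightWith g a) (insertions± N σ))

  insertionSum-[] : ∀ {n} g x → InRange (suc n) x →
                    insertionSum (suc n) g x [] ≡ g true true - g false false
  insertionSum-[] g x x∈ =
    trans (cong₂ (λ b c → g b b *ℤ 1ℤ +ℤ (g c c *ℤ -1ℤ +ℤ + 0)) (InRange.<top x∈) (InRange.≮bottom x∈))
          (evaluate (g true true) (g false false))
    where
    evaluate : ∀ u v → u *ℤ 1ℤ +ℤ (v *ℤ -1ℤ +ℤ + 0) ≡ u - v
    evaluate = solve-∀

  insertionSum-∷ : ∀ {n} g a x ρ → InRange (suc n) x → All (InRange (suc n)) ρ →
                   a ≢ x → Linked _≢_ (x ∷ ρ) →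
    insertionSum (suc n) g a (x ∷ ρ)
      ≡ weightWith g a (+ suc n ∷ x ∷ ρ) +ℤ weightWith g a (- + suc n ∷ x ∷ ρ)
        +ℤ sgn (headInversions x ρ) *ℤ insertionSum (suc n) (peel (a <ᶻ x) g) x ρ
  insertionSum-∷ {n} g a x ρ x∈ ρ∈ a≢x x∷ρ-linked = begin
      insertionSum (suc n) g a (x ∷ ρ)
    ≡⟨ sumℤ-map-++ (weightWith g a) (insertions N (x ∷ ρ)) (insertions M (x ∷ ρ)) ⟩
      (weightWith g a (N ∷ x ∷ ρ) +ℤ sumℤ (map (weightWith g a) (map (x ∷_) (insertions N ρ))))
        +ℤ (weightWith g a (M ∷ x ∷ ρ) +ℤ sumℤ (map (weightWith g a) (map (x ∷_) (insertions M ρ))))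
    ≡⟨ cong₂ _+ℤ_ (cong (weightWith g a (N ∷ x ∷ ρ) +ℤ_) (behindHead N topParity top∉))
                  (cong (weightWith g a (M ∷ x ∷ ρ) +ℤ_) (behindHead M bottomParity bottom∉)) ⟩
      (weightWith g a (N ∷ x ∷ ρ) +ℤ S *ℤ sumBehind N) +ℤ (weightWith g a (M ∷ x ∷ ρ) +ℤ S *ℤ sumBehind M)
    ≡⟨ regroup (weightWith g a (N ∷ x ∷ ρ)) (weightWith g a (M ∷ x ∷ ρ)) S (sumBehind N) (sumBehind M) ⟩
      weightWith g a (N ∷ x ∷ ρ) +ℤ weightWith g a (M ∷ x ∷ ρ) +ℤ S *ℤ (sumBehind N +ℤ sumBehind M)
    ≡⟨ cong (λ s → weightWith g a (N ∷ x ∷ ρ) +ℤ weightWith g a (M ∷ x ∷ ρ) +ℤ S *ℤ s)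
            (sym (sumℤ-map-++ (weightWith h x) (insertions N ρ) (insertions M ρ))) ⟩
      weightWith g a (N ∷ x ∷ ρ) +ℤ weightWith g a (M ∷ x ∷ ρ) +ℤ S *ℤ insertionSum (suc n) h x ρ ∎
    where
    open ≡-Reasoning
    N = + suc n
    M = - + suc n
    h = peel (a <ᶻ x) g
    S = sgn (headInversions x ρ)
    sumBehind : ℤ → ℤ
    sumBehind z = sumℤ (map (weightWith h x) (insertions z ρ))
    regroup : ∀ A B S C D → A +ℤ S *ℤ C +ℤ (B +ℤ S *ℤ D) ≡ A +ℤ B +ℤ S *ℤ (C +ℤ D)
    regroup = solve-∀
    behindHead : ∀ z → (z <ᶻ x) ≡ (z <ᶻ - x) → All (z ≢_) (x ∷ ρ) →
      sumℤ (map (weightWith g a) (map (x ∷_) (insertions z ρ))) ≡ S *ℤ sumBehind z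
    behindHead z parity z∉ = begin
        sumℤ (map (weightWith g a) (map (x ∷_) (insertions z ρ)))
      ≡⟨ cong sumℤ (sym (Listₚ.map-∘ (insertions z ρ))) ⟩
        sumℤ (map (weightWith g a ∘ (x ∷_)) (insertions z ρ))
      ≡⟨ sumℤ-map-cong (insertions z ρ) pointwise ⟩
        sumℤ (map (λ τ → S *ℤ weightWith h x τ) (insertions z ρ))
      ≡⟨ sumℤ-map-*ˡ S (weightWith h x) (insertions z ρ) ⟩
        S *ℤ sumBehind z ∎
      where
      pointwise : ∀ {τ} → τ ∈ insertions z ρ → weightWith g a (x ∷ τ) ≡ S *ℤ weightWith h x τ
      pointwise {[]}    []∈ = ⊥-elim ([]∉insertions ρ []∈)
      pointwise {t ∷ τ} τ∈ with linked-insertions z∉ x∷ρ-linked τ∈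
      ... | x≢t ∷ _ = trans (weightWith-peel g a x t τ a≢x x≢t)
                            (cong (_*ℤ weightWith h x (t ∷ τ)) (sgn-headInversions-insertions {x} ρ parity τ∈))
    topParity : (N <ᶻ x) ≡ (N <ᶻ - x)
    topParity = trans (InRange.top≮ x∈) (sym (InRange.top≮- x∈))
    bottomParity : (M <ᶻ x) ≡ (M <ᶻ - x)
    bottomParity = trans (InRange.bottom< x∈) (sym (InRange.bottom<- x∈))
    top∉ : All (N ≢_) (x ∷ ρ)
    top∉ = All.map (≢-sym ∘ InRange.≢top) (x∈ ∷ ρ∈)
    bottom∉ : All (M ≢_) (x ∷ ρ)
    bottom∉ = All.map (≢-sym ∘ InRange.≢bottom) (x∈ ∷ ρ∈)

  weightWith-top : ∀ {n} g a x ρ → InRange (suc n) a → All (InRange (suc n)) (x ∷ ρ) →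
    weightWith g a (+ suc n ∷ x ∷ ρ)
      ≡ g true (lastAscent (+ suc n) (x ∷ ρ))
          *ℤ (sgn (length (x ∷ ρ)) *ℤ (p *ℤ weightAfter (+ suc n) (x ∷ ρ)))
  weightWith-top {n} g a x ρ a∈ x∷ρ∈@(x∈ ∷ _) =
    cong₂ _*ℤ_ (cong (λ b → g b (lastAscent (+ suc n) (x ∷ ρ))) (InRange.<top a∈))
      (trans (weightAfter-∷∷ a (+ suc n) x ρ (InRange.≢top a∈) (≢-sym (InRange.≢top x∈)))
             (cong₂ (λ s c → s *ℤ (c *ℤ weightAfter (+ suc n) (x ∷ ρ)))
                    (cong sgn (headInversions-top x∷ρ∈))
                    (cong₂ turn (InRange.<top a∈) (InRange.top≮ x∈))))

  weightWith-bottom : ∀ {n} g a x ρ → InRange (suc n) a → All (InRange (suc n)) (x ∷ ρ) →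
    weightWith g a (- + suc n ∷ x ∷ ρ)
      ≡ g false (lastAscent (- + suc n) (x ∷ ρ))
          *ℤ (sgn (suc (length (x ∷ ρ))) *ℤ (q *ℤ weightAfter (- + suc n) (x ∷ ρ)))
  weightWith-bottom {n} g a x ρ a∈ x∷ρ∈@(x∈ ∷ _) =
    cong₂ _*ℤ_ (cong (λ b → g b (lastAscent (- + suc n) (x ∷ ρ))) (InRange.≮bottom a∈))
      (trans (weightAfter-∷∷ a (- + suc n) x ρ (InRange.≢bottom a∈) (≢-sym (InRange.≢bottom x∈)))
             (cong₂ (λ s c → s *ℤ (c *ℤ weightAfter (- + suc n) (x ∷ ρ)))
                    (cong sgn (headInversions-bottom x∷ρ∈))
                    (cong₂ turn (InRange.≮bottom a∈) (InRange.bottom< x∈))))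

  oddTable evenTable : Boundary → Boundary
  oddTable g true  true  = g true true - + 2 *ℤ p *ℤ g true false +ℤ q *ℤ g false true
  oddTable g true  false = + 2 *ℤ q *ℤ g true true - (1ℤ +ℤ + 2 *ℤ p *ℤ q) *ℤ g true false +ℤ q *ℤ g false false
  oddTable g false true  = (1ℤ +ℤ + 2 *ℤ p *ℤ q) *ℤ g false true - p *ℤ g true true - + 2 *ℤ p *ℤ g false false
  oddTable g false false = + 2 *ℤ q *ℤ g false true - p *ℤ g true false - g false false
  evenTable g true  true  = (1ℤ +ℤ + 2 *ℤ p *ℤ q) *ℤ g true true - + 2 *ℤ p *ℤ g true false - q *ℤ g false true
  evenTable g true  false = + 2 *ℤ q *ℤ g true true - g true false - q *ℤ g false false
  evenTable g false true  = p *ℤ g true true +ℤ g false true - + 2 *ℤ p *ℤ g false false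
  evenTable g false false = p *ℤ g true false +ℤ + 2 *ℤ q *ℤ g false true - (1ℤ +ℤ + 2 *ℤ p *ℤ q) *ℤ g false false

  -- transfer n g is the boundary weight that insertionSum reads off a word of length n ≥ 1
  -- (insertionSum-transfer); only the parity of n matters.
  transfer : ℕ → Boundary → Boundary
  transfer zero          = evenTable
  transfer (suc zero)    = oddTable
  transfer (suc (suc n)) = transfer n

  onValues : {P : ℤ → ℤ → ℤ → ℤ → ℤ → ℤ → Set} → (∀ p q g₁₁ g₁₀ g₀₁ g₀₀ → P p q g₁₁ g₁₀ g₀₁ g₀₀) →
             (g : Boundary) → P p q (g true true) (g true false) (g false true) (g false false)
  onValues identity g = identity p q (g true true) (g true false) (g false true) (g false false)

  transferBase : ∀ b g →
    g true false *ℤ (sgn 1 *ℤ p) +ℤ g false true *ℤ (sgn 2 *ℤ q) +ℤ (peel b g true true - peel b g false false)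
      ≡ oddTable g b b
  transferBase true  = onValues oddBase-T
  transferBase false = onValues oddBase-F

  transferStep : ∀ n b f e g →
    g true e *ℤ (sgn (suc n) *ℤ (p *ℤ turn false f)) +ℤ g false e *ℤ (sgn (suc (suc n)) *ℤ (q *ℤ turn true f))
      +ℤ transfer n (peel b g) f e
      ≡ transfer (suc n) g b e *ℤ turn b f
  transferStep 0 true  true  true  = onValues oddStep-TTT
  transferStep 0 true  true  false = onValues oddStep-TTF
  transferStep 0 true  false true  = onValues oddStep-TFT
  transferStep 0 true  false false = onValues oddStep-TFF
  transferStep 0 false true  true  = onValues oddStep-FTT
  transferStep 0 false true  false = onValues oddStep-FTF
  transferStep 0 false false true  = onValues oddStep-FFT
  transferStep 0 false false false = onValues oddStep-FFF
  transferStep 1 true  true  true  = onValues evenStep-TTT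
  transferStep 1 true  true  false = onValues evenStep-TTF
  transferStep 1 true  false true  = onValues evenStep-TFT
  transferStep 1 true  false false = onValues evenStep-TFF
  transferStep 1 false true  true  = onValues evenStep-FTT
  transferStep 1 false true  false = onValues evenStep-FTF
  transferStep 1 false false true  = onValues evenStep-FFT
  transferStep 1 false false false = onValues evenStep-FFF
  transferStep (suc (suc n)) b f e g =
    trans (cong₂ (λ s s′ → g true e *ℤ (s *ℤ (p *ℤ turn false f)) +ℤ g false e *ℤ (s′ *ℤ (q *ℤ turn true f))
                             +ℤ transfer n (peel b g) f e)
                 (sgn-+2 (suc n)) (sgn-+2 (suc (suc n))))
          (transferStep n b f e g)

  weightAfter-top-∷∷ : ∀ {n} x y σ → InRange (suc n) x → x ≢ y →
    weightAfter (+ suc n) (x ∷ y ∷ σ)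
      ≡ sgn (headInversions x (y ∷ σ)) *ℤ (turn false (x <ᶻ y) *ℤ weightAfter x (y ∷ σ))
  weightAfter-top-∷∷ x y σ x∈ x≢y =
    trans (weightAfter-∷∷ _ x y σ (≢-sym (InRange.≢top x∈)) x≢y)
          (cong (λ c → sgn (headInversions x (y ∷ σ)) *ℤ (turn c (x <ᶻ y) *ℤ weightAfter x (y ∷ σ)))
                (InRange.top≮ x∈))

  weightAfter-bottom-∷∷ : ∀ {n} x y σ → InRange (suc n) x → x ≢ y →
    weightAfter (- + suc n) (x ∷ y ∷ σ)
      ≡ sgn (headInversions x (y ∷ σ)) *ℤ (turn true (x <ᶻ y) *ℤ weightAfter x (y ∷ σ))
  weightAfter-bottom-∷∷ x y σ x∈ x≢y =
    trans (weightAfter-∷∷ _ x y σ (≢-sym (InRange.≢bottom x∈)) x≢y)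
          (cong (λ c → sgn (headInversions x (y ∷ σ)) *ℤ (turn c (x <ᶻ y) *ℤ weightAfter x (y ∷ σ)))
                (InRange.bottom< x∈))

  insertionSum-[-] : ∀ {n} g a x → Admissible (suc n) (a ∷ x ∷ []) →
    insertionSum (suc n) g a (x ∷ []) ≡ oddTable g (a <ᶻ x) (a <ᶻ x) *ℤ weightAfter a (x ∷ [])
  insertionSum-[-] {n} g a x (a∈ ∷ x∈ ∷ [] , a≢x ∷ [-]) = begin
      insertionSum (suc n) g a (x ∷ [])
    ≡⟨ insertionSum-∷ g a x [] x∈ [] a≢x [-] ⟩
      weightWith g a (+ suc n ∷ x ∷ []) +ℤ weightWith g a (- + suc n ∷ x ∷ [])
        +ℤ sgn (headInversions x []) *ℤ insertionSum (suc n) h x []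
    ≡⟨ cong₂ _+ℤ_ (cong₂ _+ℤ_ frontTop frontBottom)
                  (cong₂ _*ℤ_ (sym (weightAfter-[-] a x)) (insertionSum-[] h x x∈)) ⟩
      g true false *ℤ (sgn 1 *ℤ (p *ℤ V)) +ℤ g false true *ℤ (sgn 2 *ℤ (q *ℤ V))
        +ℤ V *ℤ (h true true - h false false)
    ≡⟨ scale-base (g true false) (g false true) (sgn 1) (sgn 2) p q (h true true - h false false)
                  (oddTable g b b) V (transferBase b g) ⟩
      oddTable g b b *ℤ V ∎
    where
    open ≡-Reasoning
    b = a <ᶻ x
    h = peel b g
    V = weightAfter a (x ∷ [])
    frontTop : weightWith g a (+ suc n ∷ x ∷ []) ≡ g true false *ℤ (sgn 1 *ℤ (p *ℤ V))
    frontTop = trans (weightWith-top g a x [] a∈ (x∈ ∷ []))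
                     (cong (λ e → g true e *ℤ (sgn 1 *ℤ (p *ℤ V))) (InRange.top≮ x∈))
    frontBottom : weightWith g a (- + suc n ∷ x ∷ []) ≡ g false true *ℤ (sgn 2 *ℤ (q *ℤ V))
    frontBottom = trans (weightWith-bottom g a x [] a∈ (x∈ ∷ []))
                        (cong (λ e → g false e *ℤ (sgn 2 *ℤ (q *ℤ V))) (InRange.bottom< x∈))

  insertionSum-∷∷ : ∀ {n} g a x y σ → Admissible (suc n) (a ∷ x ∷ y ∷ σ) →
    insertionSum (suc n) (peel (a <ᶻ x) g) x (y ∷ σ)
      ≡ transfer (length (y ∷ σ)) (peel (a <ᶻ x) g) (x <ᶻ y) (lastAscent x (y ∷ σ))
          *ℤ weightAfter x (y ∷ σ) →
    insertionSum (suc n) g a (x ∷ y ∷ σ)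
      ≡ transfer (length (x ∷ y ∷ σ)) g (a <ᶻ x) (lastAscent x (y ∷ σ)) *ℤ weightAfter a (x ∷ y ∷ σ)
  insertionSum-∷∷ {n} g a x y σ (a∈ ∷ x∈ ∷ y∷σ∈ , a≢x ∷ x∷y∷σ-linked@(x≢y ∷ _)) behind = begin
      insertionSum (suc n) g a (x ∷ y ∷ σ)
    ≡⟨ insertionSum-∷ g a x (y ∷ σ) x∈ y∷σ∈ a≢x x∷y∷σ-linked ⟩
      weightWith g a (+ suc n ∷ x ∷ y ∷ σ) +ℤ weightWith g a (- + suc n ∷ x ∷ y ∷ σ)
        +ℤ S *ℤ insertionSum (suc n) h x (y ∷ σ)
    ≡⟨ cong₂ _+ℤ_ (cong₂ _+ℤ_ frontTop frontBottom) (cong (S *ℤ_) behind) ⟩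
      g true e *ℤ (sgn (suc m) *ℤ (p *ℤ (S *ℤ (turn false f *ℤ V))))
        +ℤ g false e *ℤ (sgn (suc (suc m)) *ℤ (q *ℤ (S *ℤ (turn true f *ℤ V))))
        +ℤ S *ℤ (transfer m h f e *ℤ V)
    ≡⟨ scale-step (g true e) (g false e) (sgn (suc m)) (sgn (suc (suc m))) p q (turn false f)
                  (turn true f) (turn b f) (transfer m h f e) (transfer (suc m) g b e) S V
                  (transferStep m b f e g) ⟩
      transfer (suc m) g b e *ℤ (S *ℤ (turn b f *ℤ V))
    ≡⟨ cong (transfer (suc m) g b e *ℤ_) (sym (weightAfter-∷∷ a x y σ a≢x x≢y)) ⟩
      transfer (suc m) g b e *ℤ weightAfter a (x ∷ y ∷ σ) ∎
    where
    open ≡-Reasoning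
    m = length (y ∷ σ)
    b = a <ᶻ x
    f = x <ᶻ y
    e = lastAscent x (y ∷ σ)
    h = peel b g
    S = sgn (headInversions x (y ∷ σ))
    V = weightAfter x (y ∷ σ)
    frontTop : weightWith g a (+ suc n ∷ x ∷ y ∷ σ)
                 ≡ g true e *ℤ (sgn (suc m) *ℤ (p *ℤ (S *ℤ (turn false f *ℤ V))))
    frontTop = trans (weightWith-top g a x (y ∷ σ) a∈ (x∈ ∷ y∷σ∈))
                     (cong (λ w → g true e *ℤ (sgn (suc m) *ℤ (p *ℤ w)))
                           (weightAfter-top-∷∷ x y σ x∈ x≢y))
    frontBottom : weightWith g a (- + suc n ∷ x ∷ y ∷ σ)
                    ≡ g false e *ℤ (sgn (suc (suc m)) *ℤ (q *ℤ (S *ℤ (turn true f *ℤ V))))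
    frontBottom = trans (weightWith-bottom g a x (y ∷ σ) a∈ (x∈ ∷ y∷σ∈))
                        (cong (λ w → g false e *ℤ (sgn (suc (suc m)) *ℤ (q *ℤ w)))
                              (weightAfter-bottom-∷∷ x y σ x∈ x≢y))

  insertionSum-transfer : ∀ {n} g a x σ → Admissible (suc n) (a ∷ x ∷ σ) →
    insertionSum (suc n) g a (x ∷ σ)
      ≡ transfer (length (x ∷ σ)) g (a <ᶻ x) (lastAscent a (x ∷ σ)) *ℤ weightAfter a (x ∷ σ)
  insertionSum-transfer g a x []      admissible = insertionSum-[-] g a x admissible
  insertionSum-transfer g a x (y ∷ σ) admissible@(_ ∷ x∷y∷σ∈ , _ ∷ x∷y∷σ-linked) =
    insertionSum-∷∷ g a x y σ admissible
      (insertionSum-transfer (peel (a <ᶻ x) g) x y σ (x∷y∷σ∈ , x∷y∷σ-linked))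

  boundarySum : Boundary → ℕ → ℤ
  boundarySum g n = sumℤ (map (weightWith g (+ 0)) (𝔅 n))

  boundarySum-1 : ∀ g → boundarySum g 1 ≡ g true true - g false false
  boundarySum-1 g =
    trans (sumℤ-map-concatMap (weightWith g (+ 0)) (insertions± 1) (𝔅 0))
          (trans (ℤₚ.+-identityʳ (insertionSum 1 g (+ 0) []))
                 (insertionSum-[] g (+ 0) (0-InRange {0})))

  boundarySum-transfer : ∀ n g → boundarySum g (suc (suc n)) ≡ boundarySum (transfer (suc n) g) (suc n)
  boundarySum-transfer n g =
    trans (sumℤ-map-concatMap (weightWith g (+ 0)) (insertions± (suc (suc n))) (𝔅 (suc n)))
          (sumℤ-map-cong (𝔅 (suc n)) pointwise)
    where
    pointwise : ∀ {σ} → σ ∈ 𝔅 (suc n) →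
                insertionSum (suc (suc n)) g (+ 0) σ ≡ weightWith (transfer (suc n) g) (+ 0) σ
    pointwise {[]}    []∈ with () ← proj₁ (∈-𝔅⁻ (suc n) []∈)
    pointwise {x ∷ σ} σ∈ =
      trans (insertionSum-transfer g (+ 0) x σ (𝔅-admissible (suc n) σ∈))
            (cong (λ k → transfer k g (+ 0 <ᶻ x) (lastAscent (+ 0) (x ∷ σ)) *ℤ weightAfter (+ 0) (x ∷ σ))
                  (proj₁ (∈-𝔅⁻ (suc n) σ∈)))

  closedForm : ℕ → Boundary → ℤ
  closedForm zero          g = g true true - g false false
  closedForm (suc zero)    g = g true true +ℤ g false false - q *ℤ g false true - p *ℤ g true false
  closedForm (suc (suc n)) g = (1ℤ - p *ℤ q) *ℤ closedForm n g

  closedForm-transfer : ∀ n g → closedForm (suc n) g ≡ closedForm n (transfer (suc n) g)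
  closedForm-transfer zero          = onValues closed-odd
  closedForm-transfer (suc zero)    = onValues closed-even
  closedForm-transfer (suc (suc n)) g = cong ((1ℤ - p *ℤ q) *ℤ_) (closedForm-transfer n g)

  boundarySum-closedForm : ∀ n g → boundarySum g (suc n) ≡ closedForm n g
  boundarySum-closedForm zero    g = boundarySum-1 g
  boundarySum-closedForm (suc n) g =
    trans (boundarySum-transfer n g)
          (trans (boundarySum-closedForm n (transfer (suc n) g)) (sym (closedForm-transfer n g)))

  closedForm-periodic : ∀ k r g → closedForm (k * 2 + r) g ≡ (1ℤ - p *ℤ q) ^ℤ k *ℤ closedForm r g
  closedForm-periodic zero    r g = sym (ℤₚ.*-identityˡ _)
  closedForm-periodic (suc k) r g =
    trans (cong ((1ℤ - p *ℤ q) *ℤ_) (closedForm-periodic k r g))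
          (sym (ℤₚ.*-assoc (1ℤ - p *ℤ q) ((1ℤ - p *ℤ q) ^ℤ k) (closedForm r g)))

  boundarySum-+2 : ∀ g n → boundarySum g (suc (suc (suc n))) ≡ (1ℤ - p *ℤ q) *ℤ boundarySum g (suc n)
  boundarySum-+2 g n =
    trans (boundarySum-closedForm (suc (suc n)) g)
          (cong ((1ℤ - p *ℤ q) *ℤ_) (sym (boundarySum-closedForm n g)))

  boundarySum-even : ∀ g k → boundarySum g (2 * suc k) ≡ (1ℤ - p *ℤ q) ^ℤ k *ℤ closedForm 1 g
  boundarySum-even g k =
    trans (cong (boundarySum g) (index k))
          (trans (boundarySum-closedForm (k * 2 + 1) g) (closedForm-periodic k 1 g))
    where
    index : ∀ k → 2 * suc k ≡ suc (k * 2 + 1)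
    index = ℕ-Solver.solve-∀

  boundarySum-odd : ∀ g k → boundarySum g (2 * suc k + 1) ≡ (1ℤ - p *ℤ q) ^ℤ suc k *ℤ closedForm 0 g
  boundarySum-odd g k =
    trans (cong (boundarySum g) (index k))
          (trans (boundarySum-closedForm (suc k * 2 + 0) g) (closedForm-periodic (suc k) 0 g))
    where
    index : ∀ k → 2 * suc k + 1 ≡ suc (suc k * 2 + 0)
    index = ℕ-Solver.solve-∀

if-then-zero : ∀ b w → (if b then w else 0ℤ) ≡ (if b then 1ℤ else 0ℤ) *ℤ w
if-then-zero true  w = sym (ℤₚ.*-identityˡ w)
if-then-zero false w = sym (ℤₚ.*-zeroˡ w)

lastTwo-flip : ∀ {a x w} → Linked _≢_ (a ∷ x ∷ w) →
               lastTwo (λ u v → v <ᶻ u) (a ∷ x ∷ w) ≡ not (lastTwo _<ᶻ_ (a ∷ x ∷ w))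
lastTwo-flip {w = []}    (a≢x ∷ [-]) = <ᶻ-flip a≢x
lastTwo-flip {w = _ ∷ _} (_ ∷ l)     = lastTwo-flip l

module Specialisations (p q : ℤ) where
  open Weights p q

  endsAscending endsDescending anyEnd : Boundary
  endsAscending  _ e = if e then 1ℤ else 0ℤ
  endsDescending _ e = if not e then 1ℤ else 0ℤ
  anyEnd         _ _ = 1ℤ

  filterᵇ-boundarySum : ∀ (P : List ℤ → Bool) g n →
    (∀ {π} → π ∈ 𝔅 n → (if P π then weight p q π else 0ℤ) ≡ weightWith g (+ 0) π) →
    sumℤ (map (weight p q) (filterᵇ P (signedPerms n))) ≡ boundarySum g n
  filterᵇ-boundarySum P g n pointwise = begin
      sumℤ (map (weight p q) (filterᵇ P (signedPerms n)))
    ≡⟨ sumℤ-map-filterᵇ P (weight p q) (signedPerms n) ⟩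
      sumℤ (map (λ π → if P π then weight p q π else 0ℤ) (signedPerms n))
    ≡⟨ sumℤ-map-↭ (λ π → if P π then weight p q π else 0ℤ) (signedPerms↭𝔅 n) ⟩
      sumℤ (map (λ π → if P π then weight p q π else 0ℤ) (𝔅 n))
    ≡⟨ sumℤ-map-cong (𝔅 n) pointwise ⟩
      boundarySum g n ∎
    where open ≡-Reasoning

  SgnBAltrunA-boundarySum : ∀ n → SgnBAltrunA n p q ≡ boundarySum endsAscending n
  SgnBAltrunA-boundarySum n =
    filterᵇ-boundarySum endAsc endsAscending n (λ {π} _ → if-then-zero (endAsc π) (weight p q π))

  SgnBAltrunD-boundarySum : ∀ n → SgnBAltrunD (suc n) p q ≡ boundarySum endsDescending (suc n)
  SgnBAltrunD-boundarySum n = filterᵇ-boundarySum endDesc endsDescending (suc n) pointwise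
    where
    pointwise : ∀ {π} → π ∈ 𝔅 (suc n) →
                (if endDesc π then weight p q π else 0ℤ) ≡ weightWith endsDescending (+ 0) π
    pointwise {[]}    []∈ with () ← proj₁ (∈-𝔅⁻ (suc n) []∈)
    pointwise {x ∷ π} π∈ =
      trans (cong (λ b → if b then weight p q (x ∷ π) else 0ℤ)
                  (lastTwo-flip (proj₂ (𝔅-admissible (suc n) π∈))))
            (if-then-zero (not (endAsc (x ∷ π))) (weight p q (x ∷ π)))

  SgnBAltrun-boundarySum : ∀ n → SgnBAltrun n p q ≡ boundarySum anyEnd n
  SgnBAltrun-boundarySum n =
    trans (sumℤ-map-↭ (weight p q) (signedPerms↭𝔅 n))
          (sumℤ-map-cong (𝔅 n) (λ {π} _ → sym (ℤₚ.*-identityˡ (weight p q π))))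

  SgnBAltrunA-recurrence : ∀ m → SgnBAltrunA (m + 3) p q ≡ (+ 1 - p *ℤ q) *ℤ SgnBAltrunA (suc m) p q
  SgnBAltrunA-recurrence m = begin
      SgnBAltrunA (m + 3) p q
    ≡⟨ cong (λ n → SgnBAltrunA n p q) (ℕₚ.+-comm m 3) ⟩
      SgnBAltrunA (3 + m) p q
    ≡⟨ SgnBAltrunA-boundarySum (3 + m) ⟩
      boundarySum endsAscending (3 + m)
    ≡⟨ boundarySum-+2 endsAscending m ⟩
      (1ℤ - p *ℤ q) *ℤ boundarySum endsAscending (suc m)
    ≡⟨ cong ((1ℤ - p *ℤ q) *ℤ_) (sym (SgnBAltrunA-boundarySum (suc m))) ⟩
      (1ℤ - p *ℤ q) *ℤ SgnBAltrunA (suc m) p q ∎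
    where open ≡-Reasoning

  SgnBAltrunD-recurrence : ∀ m → SgnBAltrunD (m + 3) p q ≡ (+ 1 - p *ℤ q) *ℤ SgnBAltrunD (suc m) p q
  SgnBAltrunD-recurrence m = begin
      SgnBAltrunD (m + 3) p q
    ≡⟨ cong (λ n → SgnBAltrunD n p q) (ℕₚ.+-comm m 3) ⟩
      SgnBAltrunD (3 + m) p q
    ≡⟨ SgnBAltrunD-boundarySum (2 + m) ⟩
      boundarySum endsDescending (3 + m)
    ≡⟨ boundarySum-+2 endsDescending m ⟩
      (1ℤ - p *ℤ q) *ℤ boundarySum endsDescending (suc m)
    ≡⟨ cong ((1ℤ - p *ℤ q) *ℤ_) (sym (SgnBAltrunD-boundarySum m)) ⟩
      (1ℤ - p *ℤ q) *ℤ SgnBAltrunD (suc m) p q ∎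
    where open ≡-Reasoning

  SgnBAltrunA-even : ∀ k → SgnBAltrunA (2 * suc k) p q ≡ (+ 1 - q) *ℤ ((+ 1 - p *ℤ q) ^ℤ k)
  SgnBAltrunA-even k = trans (SgnBAltrunA-boundarySum (2 * suc k))
    (trans (boundarySum-even endsAscending k) (evaluate ((1ℤ - p *ℤ q) ^ℤ k) p q))
    where
    evaluate : ∀ U p q → U *ℤ (1ℤ +ℤ 0ℤ - q *ℤ 1ℤ - p *ℤ 0ℤ) ≡ (1ℤ - q) *ℤ U
    evaluate = solve-∀

  SgnBAltrunA-odd : ∀ k → SgnBAltrunA (2 * suc k + 1) p q ≡ (+ 1 - p *ℤ q) ^ℤ suc k
  SgnBAltrunA-odd k = trans (SgnBAltrunA-boundarySum (2 * suc k + 1))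
    (trans (boundarySum-odd endsAscending k) (ℤₚ.*-identityʳ ((1ℤ - p *ℤ q) ^ℤ suc k)))

  -- 2 * suc k and 2 * suc k + 1 reduce to suc (ℕ.pred …), the form SgnBAltrunD-boundarySum needs.
  SgnBAltrunD-even : ∀ k → SgnBAltrunD (2 * suc k) p q ≡ (+ 1 - p) *ℤ ((+ 1 - p *ℤ q) ^ℤ k)
  SgnBAltrunD-even k = trans (SgnBAltrunD-boundarySum (ℕ.pred (2 * suc k)))
    (trans (boundarySum-even endsDescending k) (evaluate ((1ℤ - p *ℤ q) ^ℤ k) p q))
    where
    evaluate : ∀ U p q → U *ℤ (0ℤ +ℤ 1ℤ - q *ℤ 0ℤ - p *ℤ 1ℤ) ≡ (1ℤ - p) *ℤ U
    evaluate = solve-∀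

  SgnBAltrunD-odd : ∀ k → SgnBAltrunD (2 * suc k + 1) p q ≡ - ((+ 1 - p *ℤ q) ^ℤ suc k)
  SgnBAltrunD-odd k = trans (SgnBAltrunD-boundarySum (ℕ.pred (2 * suc k + 1)))
    (trans (boundarySum-odd endsDescending k) (evaluate ((1ℤ - p *ℤ q) ^ℤ suc k)))
    where
    evaluate : ∀ U → U *ℤ -1ℤ ≡ - U
    evaluate = solve-∀

  SgnBAltrun-even : ∀ k → SgnBAltrun (2 * suc k) p q ≡ (+ 2 - p - q) *ℤ ((+ 1 - p *ℤ q) ^ℤ k)
  SgnBAltrun-even k = trans (SgnBAltrun-boundarySum (2 * suc k))
    (trans (boundarySum-even anyEnd k) (evaluate ((1ℤ - p *ℤ q) ^ℤ k) p q))
    where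
    evaluate : ∀ U p q → U *ℤ (1ℤ +ℤ 1ℤ - q *ℤ 1ℤ - p *ℤ 1ℤ) ≡ (+ 2 - p - q) *ℤ U
    evaluate = solve-∀

  SgnBAltrun-odd : ∀ k → SgnBAltrun (2 * suc k + 1) p q ≡ 0ℤ
  SgnBAltrun-odd k = trans (SgnBAltrun-boundarySum (2 * suc k + 1))
    (trans (boundarySum-odd anyEnd k) (ℤₚ.*-zeroʳ ((1ℤ - p *ℤ q) ^ℤ suc k)))

theorem35 : (p q : ℤ) →
    ((m : ℕ) → SgnBAltrunA (m + 3) p q ≡ (+ 1 - p *ℤ q) *ℤ SgnBAltrunA (suc m) p q)
    × ((m : ℕ) → SgnBAltrunD (m + 3) p q ≡ (+ 1 - p *ℤ q) *ℤ SgnBAltrunD (suc m) p q)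
    × ((k : ℕ) → SgnBAltrunA (2 * suc k) p q ≡ (+ 1 - q) *ℤ ((+ 1 - p *ℤ q) ^ℤ k))
    × ((k : ℕ) → SgnBAltrunA (2 * suc k + 1) p q ≡ (+ 1 - p *ℤ q) ^ℤ suc k)
    × ((k : ℕ) → SgnBAltrunD (2 * suc k) p q ≡ (+ 1 - p) *ℤ ((+ 1 - p *ℤ q) ^ℤ k))
    × ((k : ℕ) → SgnBAltrunD (2 * suc k + 1) p q ≡ - ((+ 1 - p *ℤ q) ^ℤ suc k))
    × ((k : ℕ) → SgnBAltrun (2 * suc k) p q ≡ ((+ 2 - p) - q) *ℤ ((+ 1 - p *ℤ q) ^ℤ k))
    × ((k : ℕ) → SgnBAltrun (2 * suc k + 1) p q ≡ + 0)
theorem35 p q =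
  SgnBAltrunA-recurrence , SgnBAltrunD-recurrence ,
  SgnBAltrunA-even , SgnBAltrunA-odd , SgnBAltrunD-even , SgnBAltrunD-odd ,
  SgnBAltrun-even , SgnBAltrun-odd
  where open Specialisations p q
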